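{- Let $p$ be a prime and $G$ a finite abelian $p$-group with $\exp(G)=n$. Let $\gamma,\beta\geqslant 0$ and $k\geqslant 2$ be integers. If $J$ is a sequence over $G$ of length $t$ with $\mathsf{D}(G)+n-1-\gamma\leqslant t\leqslant kn-1-\gamma-\beta$, then $$\sum_{j=0}^{k-1}(-1)^j\left(\sum_{i=0}^{\gamma}\binom{\gamma}{i}N_{jn-i-\beta}(J)\right)\equiv0\pmod p.$$
   Context: A sequence over $G$ is a finite list $X=g_1\cdots g_t$ of elements of $G$ (repetitions allowed, order irrelevant). $\mathsf{D}(G)$ (Davenport constant) is the smallest positive integer $N$ such that every sequence over $G$ of length at least $N$ has a nonempty subsequence with sum $0$. For an integer $m$, $N_m(X)$ denotes the number of subsequences of $X$ of length $m$ with sum $0$, counted as index sets, i.e. the number of subsets $I\subseteq\{1,\dots,t\}$ with $|I|=m$ and $\sum_{i\in I}g_i=0$. In particular $N_0(X)=1$ and $N_m(X)=0$ if $m<0$ or $m>t$. -}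

module Defs where

open import Level using (Level)
open import Algebra.Bundles using (AbelianGroup)
open import Data.Nat using (ℕ; zero; suc; _≤_; _^_; _*_)
open import Data.Nat.Primality using (Prime)
open import Data.Nat.Combinatorics using (_C_)
open import Data.Integer as ℤ using (ℤ; +_; -[1+_])
open import Data.Bool using (Bool; true; false)
open import Data.Vec using (Vec; []; _∷_)
open import Data.List as List using (List)
open import Data.Fin.Subset using (Subset; ∣_∣; Nonempty; inside; outside)
open import Data.Product using (Σ; ∃; _×_; _,_)
open import Relation.Nullary using (Dec; ¬_; _×-dec_)
open import Relation.Unary using (Decidable)
open import Relation.Binary.PropositionalEquality using (_≡_)
import Data.Nat as ℕ
open import Data.List.Relation.Unary.Any using (Any)

record FiniteAbelianGroup (c ℓ : Level) : Set (Level.suc (c Level.⊔ ℓ)) where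
  field
    abelianGroup : AbelianGroup c ℓ
  open AbelianGroup abelianGroup public
  field
    _≟_      : (x y : Carrier) → Dec (x ≈ y)
    elements : List Carrier
    complete : ∀ x → Any (x ≈_) elements

module _ {c ℓ : Level} (G : FiniteAbelianGroup c ℓ) where
  open FiniteAbelianGroup G

  _·_ : ℕ → Carrier → Carrier
  zero  · g = ε
  suc m · g = g ∙ (m · g)

  IsPGroup : ℕ → Set (c Level.⊔ ℓ)
  IsPGroup p = ∀ g → ∃ λ e → ((p ^ e) · g) ≈ ε

  IsExponent : ℕ → Set (c Level.⊔ ℓ)
  IsExponent n = (1 ≤ n) × (∀ g → (n · g) ≈ ε)
               × (∀ m → 1 ≤ m → (∀ g → (m · g) ≈ ε) → n ≤ m)

  subSum : ∀ {t} → Subset t → Vec Carrier t → Carrier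
  subSum []             []       = ε
  subSum (inside  ∷ I) (x ∷ X)  = x ∙ subSum I X
  subSum (outside ∷ I) (x ∷ X)  = subSum I X

  HasZeroSum : ∀ {t} → Vec Carrier t → Set ℓ
  HasZeroSum {t} X = Σ (Subset t) λ I → Nonempty I × (subSum I X ≈ ε)

  ZeroSumFrom : ℕ → Set (c Level.⊔ ℓ)
  ZeroSumFrom N = ∀ t → N ≤ t → (X : Vec Carrier t) → HasZeroSum X

  IsDavenport : ℕ → Set (c Level.⊔ ℓ)
  IsDavenport D = (1 ≤ D) × ZeroSumFrom D × (∀ N → 1 ≤ N → ZeroSumFrom N → D ≤ N)

  allSubsets : (t : ℕ) → List (Subset t)
  allSubsets zero    = [] List.∷ List.[]
  allSubsets (suc t) = List.map (inside ∷_) (allSubsets t) List.++ List.map (outside ∷_) (allSubsets t)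

  N : ∀ {t} → ℕ → Vec Carrier t → ℕ
  N {t} m X = List.length (List.filter (λ I → (∣ I ∣ ℕ.≟ m) ×-dec (subSum I X ≟ ε)) (allSubsets t))

  Nℤ : ∀ {t} → ℤ → Vec Carrier t → ℕ
  Nℤ (+ m)    X = N m X
  Nℤ -[1+ m ] X = 0

sumℤ : ℕ → (ℕ → ℤ) → ℤ
sumℤ zero    f = + 0
sumℤ (suc n) f = sumℤ n f ℤ.+ f n

sign : ℕ → ℤ
sign zero    = + 1
sign (suc j) = ℤ.- sign j

-- Olson's method.  Write Δ y F x = F x − F (x − y) for F : G → ℤ; this is the action of 1 − y in ℤ[G].
-- For a finite abelian p-group G there is a w < D(G) such that any w + 1 differences Δ y₁ ⋯ Δ y_m send every F
-- to a function divisible by p.  Indeed, split G = ⟨g⟩ ⊕ H with g of maximal order p ^ a (H is the kernel of a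
-- character G → ℤ/p ^ a sending g to 1, built by extending characters one element at a time); decompose each
-- yᵢ = kᵢ g + hᵢ and expand 1 − yᵢ = (1 − kᵢ g) + (1 − hᵢ) − (1 − kᵢ g)(1 − hᵢ).  Each product then has p ^ a
-- factors from ⟨g⟩, where (1 − g) ^ (p ^ a) ≡ 1 − g ^ (p ^ a) = 0 mod p, or more than w_H factors from H.
-- The sequence of p ^ a − 1 copies of g followed by a zero-sum-free sequence of H shows w < D(G).
-- Now apply this to G × ℤ/n, n = exp G, with the sequence of γ copies of (0, 1) followed by the (gᵢ, 1), to the
-- indicator of (0, 0), evaluated at (0, −β).  Expanding the differences counts the zero-sum subsequences of J by
-- length with signs (−1) ^ (j n), and (−1) ^ (j n) ≡ (−1) ^ j mod p since n is a power of p.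

module Submission where

open import Level using (Level)
open import Data.Nat using (ℕ; _≤_)
open import Data.Nat.Primality using (Prime)
open import Defs using (FiniteAbelianGroup; sumℤ; sign)
import Defs
import Data.Nat.Properties

module Search where

  open import Data.Nat using (ℕ; zero; suc; _+_; _*_; _≤_; _<_; _≟_; z≤n; s≤s)
  open import Data.Nat.Properties using (≤-refl; m≤n⇒m≤1+n; ≤∧≢⇒<)
  open import Data.Nat.Divisibility using (_∣_; divides)
  open import Data.Nat.DivMod using (_/_; _%_; m≡m%n+[m/n]*n; m%n<n)
  open import Data.Product using (∃; _×_; _,_)
  open import Data.Sum using (_⊎_; inj₁; inj₂)
  open import Data.Empty using (⊥-elim)
  open import Relation.Nullary using (¬_; yes; no)
  open import Relation.Unary using (Decidable)
  open import Relation.Binary.PropositionalEquality using (refl; subst)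

  module _ {a} {P : ℕ → Set a} where

    Least : ℕ → Set a
    Least m = P m × (∀ k → k < m → ¬ P k)

    least-below : Decidable P → ∀ N → (∃ λ m → m < N × Least m) ⊎ (∀ k → k < N → ¬ P k)
    least-below P? zero = inj₂ (λ k ())
    least-below P? (suc N) with least-below P? N
    ... | inj₁ (m , m<N , least) = inj₁ (m , m≤n⇒m≤1+n m<N , least)
    ... | inj₂ none with P? N
    ...   | yes pN = inj₁ (N , ≤-refl , pN , none)
    ...   | no ¬pN = inj₂ none≤N
      where
      none≤N : ∀ k → k < suc N → ¬ P k
      none≤N k (s≤s k≤N) with k ≟ N
      ... | yes refl = ¬pN
      ... | no k≢N = none k (≤∧≢⇒< k≤N k≢N)

    least : Decidable P → ∀ N → P N → ∃ λ m → m ≤ N × Least m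
    least P? N pN with least-below P? (suc N)
    ... | inj₁ (m , s≤s m≤N , l) = m , m≤N , l
    ... | inj₂ none = ⊥-elim (none N ≤-refl pN)

  -- The remainder of m modulo the least positive solution is again a solution.
  least-positive-divides : ∀ {a} (P : ℕ → Set a) → P 0 → (∀ x y → P x → P y → P (x + y)) →
    (∀ x y → P (x + y) → P y → P x) →
    ∀ o → 1 ≤ o → P o → (∀ k → k < o → ¬ (1 ≤ k × P k)) → ∀ m → P m → o ∣ m
  least-positive-divides P P0 P+ P∸ o@(suc _) _ Po below m Pm with m % o | m%n<n m o | m≡m%n+[m/n]*n m o
  ... | zero   | _     | eq = divides (m / o) eq
  ... | suc r  | r<o   | eq = ⊥-elim (below (suc r) r<o (s≤s z≤n , P∸ (suc r) _ (subst P eq Pm) (multiples (m / o))))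
    where
    multiples : ∀ k → P (k * o)
    multiples zero = P0
    multiples (suc k) = P+ o (k * o) Po (multiples k)

module Primes {p : ℕ} (p-prime : Prime p) where

  open import Data.Nat using (ℕ; zero; suc; _*_; _∸_; _^_; _≤_; _<_; z≤n; s≤s; _!; nonTrivial⇒n>1)
  open import Data.Nat.Properties
  open import Data.Nat.Divisibility as ℕ∣ using (_∣_; divides; _∣?_)
  open import Data.Nat.Primality using (Prime; euclidsLemma; prime⇒irreducible; prime⇒nonZero; prime⇒nonTrivial)
  open import Data.Nat.Coprimality using (Coprime; coprime-divisor)
  open import Data.Nat.Combinatorics using (_C_; nCk≡n!/k![n-k]!; k![n∸k]!∣n!)
  open import Data.Nat.DivMod using (_/_; _%_; m/n*n≡m; m≡m%n+[m/n]*n; m%n<n)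
  open import Data.Product using (∃; _,_)
  open import Data.Sum using (_⊎_; inj₁; inj₂)
  open import Data.Empty using (⊥-elim)
  open import Relation.Nullary using (yes; no)
  open import Relation.Binary.PropositionalEquality

  private instance _ = prime⇒nonZero p-prime

  p≥2 : 2 ≤ p
  p≥2 = nonTrivial⇒n>1 p {{prime⇒nonTrivial p-prime}}

  p>0 : 0 < p
  p>0 = <-trans (s≤s z≤n) p≥2

  p^e>0 : ∀ e → 0 < p ^ e
  p^e>0 = m^n>0 p

  n∣n! : ∀ n → 0 < n → n ∣ n !
  n∣n! (suc n) _ = ℕ∣.m∣m*n (n !)

  p∣m!⇒p≤m : ∀ m → p ∣ m ! → p ≤ m
  p∣m!⇒p≤m zero p∣1 = ⊥-elim (<⇒≱ p≥2 (ℕ∣.∣⇒≤ p∣1))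
  p∣m!⇒p≤m (suc m) p∣m! with euclidsLemma (suc m) (m !) p-prime p∣m!
  ... | inj₁ p∣1+m = ℕ∣.∣⇒≤ p∣1+m
  ... | inj₂ p∣m!′ = m≤n⇒m≤1+n (p∣m!⇒p≤m m p∣m!′)

  -- p divides p! = pCk · k! · (p ∸ k)! but neither factorial.
  p∣pCk : ∀ k → 0 < k → k < p → p ∣ p C k
  p∣pCk k 0<k k<p with euclidsLemma (p C k) (k ! * (p ∸ k) !) p-prime p∣product
    where
    instance _ = k !* (p ∸ k) !≢0
    p∣product : p ∣ (p C k) * (k ! * (p ∸ k) !)
    p∣product = subst (p ∣_)
      (sym (trans (cong (_* (k ! * (p ∸ k) !)) (nCk≡n!/k![n-k]! (<⇒≤ k<p))) (m/n*n≡m (k![n∸k]!∣n! (<⇒≤ k<p)))))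
      (n∣n! p p>0)
  ... | inj₁ p∣pCk = p∣pCk
  ... | inj₂ p∣k![p∸k]! with euclidsLemma (k !) ((p ∸ k) !) p-prime p∣k![p∸k]!
  ...   | inj₁ p∣k! = ⊥-elim (<⇒≱ k<p (p∣m!⇒p≤m k p∣k!))
  ...   | inj₂ p∣[p∸k]! = ⊥-elim (<⇒≱ (∸-monoʳ-< 0<k (<⇒≤ k<p)) (p∣m!⇒p≤m (p ∸ k) p∣[p∸k]!))

  ∣p^e⇒≡p^i : ∀ e d → d ∣ p ^ e → ∃ λ i → d ≡ p ^ i
  ∣p^e⇒≡p^i zero d d∣1 = 0 , ℕ∣.∣1⇒≡1 d∣1
  ∣p^e⇒≡p^i (suc e) d d∣ with p ∣? d
  ... | yes (divides d′ refl) with ∣p^e⇒≡p^i e d′ (ℕ∣.*-cancelˡ-∣ p (subst (_∣ p * p ^ e) (*-comm d′ p) d∣))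
  ...   | i , refl = suc i , *-comm (p ^ i) p
  ∣p^e⇒≡p^i (suc e) d d∣ | no p∤d = ∣p^e⇒≡p^i e d (coprime-divisor d⊥p d∣)
    where
    d⊥p : Coprime d p
    d⊥p (k∣d , k∣p) with prime⇒irreducible p-prime k∣p
    ... | inj₁ k≡1 = k≡1
    ... | inj₂ refl = ⊥-elim (p∤d k∣d)

  p≡2⊎odd : (p ≡ 2) ⊎ (∃ λ k → p ≡ suc (2 * k))
  p≡2⊎odd with 2 ∣? p
  ... | yes 2∣p with prime⇒irreducible p-prime 2∣p
  ...   | inj₁ ()
  ...   | inj₂ 2≡p = inj₁ (sym 2≡p)
  p≡2⊎odd | no 2∤p with p % 2 | m%n<n p 2 | m≡m%n+[m/n]*n p 2
  ... | 0 | _ | eq = ⊥-elim (2∤p (divides (p / 2) eq))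
  ... | 1 | _ | eq = inj₂ (p / 2 , trans eq (cong suc (*-comm (p / 2) 2)))
  ... | suc (suc _) | s≤s (s≤s ()) | _

module Signs where

  open import Data.Nat using (zero; suc; _+_; _*_; _^_)
  open import Data.Integer using (+_; -[1+_]; -_) renaming (_+_ to _+ℤ_; _*_ to _*ℤ_; _-_ to _-ℤ_)
  open import Data.Integer.Properties using (*-identityˡ; *-identityʳ; *-assoc; neg-distribˡ-*; +-inverseʳ)
  open import Data.Integer.Divisibility.Signed using (divides) renaming (_∣_ to _∣ℤ_)
  open import Data.Product using (∃; _,_)
  open import Data.Sum using (_⊎_; inj₁; inj₂)
  open import Relation.Binary.PropositionalEquality
  import Data.Nat.Tactic.RingSolver as ℕ-Solver

  sign-+ : ∀ a b → sign (a + b) ≡ sign a *ℤ sign b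
  sign-+ zero b = sym (*-identityˡ (sign b))
  sign-+ (suc a) b = trans (cong -_ (sign-+ a b)) (neg-distribˡ-* (sign a) (sign b))

  sign≡±1 : ∀ a → (sign a ≡ + 1) ⊎ (sign a ≡ -[1+ 0 ])
  sign≡±1 zero = inj₁ refl
  sign≡±1 (suc a) with sign≡±1 a
  ... | inj₁ eq = inj₂ (cong -_ eq)
  ... | inj₂ eq = inj₁ (cong -_ eq)

  sign*sign≡1 : ∀ a → sign a *ℤ sign a ≡ + 1
  sign*sign≡1 a with sign≡±1 a
  ... | inj₁ eq rewrite eq = refl
  ... | inj₂ eq rewrite eq = refl

  sign*[sign*x]≡x : ∀ a x → sign a *ℤ (sign a *ℤ x) ≡ x
  sign*[sign*x]≡x a x = trans (sym (*-assoc (sign a) (sign a) x)) (trans (cong (_*ℤ x) (sign*sign≡1 a)) (*-identityˡ x))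

  sign[2*m]≡1 : ∀ m → sign (2 * m) ≡ + 1
  sign[2*m]≡1 m = trans (cong sign (double m)) (trans (sign-+ m m) (sign*sign≡1 m))
    where
    double : ∀ m → 2 * m ≡ m + m
    double = ℕ-Solver.solve-∀

  sign[j*odd]≡sign[j] : ∀ j k → sign (j * suc (2 * k)) ≡ sign j
  sign[j*odd]≡sign[j] j k = begin
    sign (j * suc (2 * k))        ≡⟨ cong sign (distrib j k) ⟩
    sign (j + 2 * (j * k))        ≡⟨ sign-+ j (2 * (j * k)) ⟩
    sign j *ℤ sign (2 * (j * k))  ≡⟨ cong (sign j *ℤ_) (sign[2*m]≡1 (j * k)) ⟩
    sign j *ℤ + 1                 ≡⟨ *-identityʳ (sign j) ⟩
    sign j                        ∎
    where
    open ≡-Reasoning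
    distrib : ∀ j k → j * suc (2 * k) ≡ j + 2 * (j * k)
    distrib = ℕ-Solver.solve-∀

  odd^a≡odd : ∀ k a → ∃ λ l → suc (2 * k) ^ a ≡ suc (2 * l)
  odd^a≡odd k zero = 0 , refl
  odd^a≡odd k (suc a) with odd^a≡odd k a
  ... | l , eq = k + l + 2 * (k * l) , trans (cong (suc (2 * k) *_) eq) (odd*odd k l)
    where
    odd*odd : ∀ k l → suc (2 * k) * suc (2 * l) ≡ suc (2 * (k + l + 2 * (k * l)))
    odd*odd = ℕ-Solver.solve-∀

  2∣sign-sign : ∀ a b → (+ 2) ∣ℤ (sign a -ℤ sign b)
  2∣sign-sign a b with sign≡±1 a | sign≡±1 b
  ... | inj₁ x | inj₁ y rewrite x | y = divides (+ 0) refl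
  ... | inj₁ x | inj₂ y rewrite x | y = divides (+ 1) refl
  ... | inj₂ x | inj₁ y rewrite x | y = divides (-[1+ 0 ]) refl
  ... | inj₂ x | inj₂ y rewrite x | y = divides (+ 0) refl

  module _ {p : ℕ} (p-prime : Prime p) where

    open Primes p-prime using (p≡2⊎odd)

    -- For odd p the exponents j * p ^ a and j have the same parity; mod 2 all signs agree.
    sign[j*p^a]≡sign[j] : ∀ a j → (+ p) ∣ℤ (sign (j * p ^ a) -ℤ sign j)
    sign[j*p^a]≡sign[j] a j with p≡2⊎odd
    ... | inj₁ refl = 2∣sign-sign (j * 2 ^ a) j
    ... | inj₂ (k , refl) with odd^a≡odd k a
    ...   | l , eq rewrite eq | sign[j*odd]≡sign[j] j l = divides (+ 0) (+-inverseʳ (sign j))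

    p∣sign[p]+1 : (+ p) ∣ℤ (sign p +ℤ + 1)
    p∣sign[p]+1 with p≡2⊎odd
    ... | inj₁ refl = divides (+ 1) refl
    ... | inj₂ (k , refl) rewrite sign[2*m]≡1 k = divides (+ 0) refl

module Sums where

  open import Data.Nat using (zero; suc; _+_; _<_)
  open import Data.Nat.Properties using (m≤n⇒m≤1+n; ≤-refl; +-identityʳ; +-suc; n<1+n)
  open import Data.Nat.Combinatorics using (_C_; k>n⇒nCk≡0; nCk+nC[k+1]≡[n+1]C[k+1])
  open import Data.Integer using (ℤ; +_; -[1+_]; -_) renaming (_+_ to _+ℤ_; _*_ to _*ℤ_; _-_ to _-ℤ_)
  import Data.Integer.Properties as ℤ
  open import Data.Integer.Divisibility.Signed using (divides; ∣m∣n⇒∣m+n) renaming (_∣_ to _∣ℤ_)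
  open import Data.Integer.Tactic.RingSolver using (solve-∀)
  open import Relation.Binary.PropositionalEquality
  open ≡-Reasoning

  private
    below-suc : ∀ {n} {P : ℕ → Set} → (∀ i → i < suc n → P i) → ∀ i → i < n → P i
    below-suc h i i<n = h i (m≤n⇒m≤1+n i<n)

  sumℤ-cong : ∀ n {f g : ℕ → ℤ} → (∀ i → i < n → f i ≡ g i) → sumℤ n f ≡ sumℤ n g
  sumℤ-cong zero h = refl
  sumℤ-cong (suc n) h = cong₂ _+ℤ_ (sumℤ-cong n (below-suc h)) (h n ≤-refl)

  sumℤ-zero : ∀ n (f : ℕ → ℤ) → (∀ i → i < n → f i ≡ + 0) → sumℤ n f ≡ + 0
  sumℤ-zero zero f h = refl
  sumℤ-zero (suc n) f h = cong₂ _+ℤ_ (sumℤ-zero n f (below-suc h)) (h n ≤-refl)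

  sumℤ-+ : ∀ n (f g : ℕ → ℤ) → sumℤ n (λ i → f i +ℤ g i) ≡ sumℤ n f +ℤ sumℤ n g
  sumℤ-+ zero f g = refl
  sumℤ-+ (suc n) f g = trans (cong (_+ℤ (f n +ℤ g n)) (sumℤ-+ n f g)) (interchange (sumℤ n f) (sumℤ n g) (f n) (g n))
    where
    interchange : ∀ a b c d → a +ℤ b +ℤ (c +ℤ d) ≡ a +ℤ c +ℤ (b +ℤ d)
    interchange = solve-∀

  sumℤ-distribˡ : ∀ n c (f : ℕ → ℤ) → sumℤ n (λ i → c *ℤ f i) ≡ c *ℤ sumℤ n f
  sumℤ-distribˡ zero c f = sym (ℤ.*-zeroʳ c)
  sumℤ-distribˡ (suc n) c f =
    trans (cong (_+ℤ (c *ℤ f n)) (sumℤ-distribˡ n c f)) (sym (ℤ.*-distribˡ-+ c (sumℤ n f) (f n)))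

  sumℤ-neg : ∀ n (f : ℕ → ℤ) → sumℤ n (λ i → - f i) ≡ - sumℤ n f
  sumℤ-neg n f = begin
    sumℤ n (λ i → - f i)           ≡⟨ sumℤ-cong n (λ i _ → sym (ℤ.-1*i≡-i (f i))) ⟩
    sumℤ n (λ i → -[1+ 0 ] *ℤ f i)  ≡⟨ sumℤ-distribˡ n -[1+ 0 ] f ⟩
    -[1+ 0 ] *ℤ sumℤ n f           ≡⟨ ℤ.-1*i≡-i _ ⟩
    - sumℤ n f                     ∎

  sumℤ-split : ∀ a b (f : ℕ → ℤ) → sumℤ (a + b) f ≡ sumℤ a f +ℤ sumℤ b (λ i → f (a + i))
  sumℤ-split a zero f = trans (cong (λ m → sumℤ m f) (+-identityʳ a)) (sym (ℤ.+-identityʳ _))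
  sumℤ-split a (suc b) f = begin
    sumℤ (a + suc b) f                                    ≡⟨ cong (λ m → sumℤ m f) (+-suc a b) ⟩
    sumℤ (a + b) f +ℤ f (a + b)                           ≡⟨ cong (_+ℤ f (a + b)) (sumℤ-split a b f) ⟩
    sumℤ a f +ℤ sumℤ b (λ i → f (a + i)) +ℤ f (a + b)     ≡⟨ ℤ.+-assoc (sumℤ a f) _ _ ⟩
    sumℤ a f +ℤ sumℤ (suc b) (λ i → f (a + i))            ∎

  sumℤ-head : ∀ n (f : ℕ → ℤ) → sumℤ (suc n) f ≡ f 0 +ℤ sumℤ n (λ i → f (suc i))
  sumℤ-head n f = trans (sumℤ-split 1 n f) (cong (_+ℤ sumℤ n (λ i → f (suc i))) (ℤ.+-identityˡ (f 0)))

  sumℤ-vanishing-tail : ∀ a b (f : ℕ → ℤ) → (∀ i → i < b → f (a + i) ≡ + 0) → sumℤ (a + b) f ≡ sumℤ a f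
  sumℤ-vanishing-tail a b f tail≡0 =
    trans (sumℤ-split a b f) (trans (cong (sumℤ a f +ℤ_) (sumℤ-zero b _ tail≡0)) (ℤ.+-identityʳ _))

  sumℤ-vanishing-prefix : ∀ a b (f : ℕ → ℤ) → (∀ i → i < a → f i ≡ + 0) → sumℤ (a + b) f ≡ sumℤ b (λ i → f (a + i))
  sumℤ-vanishing-prefix a b f prefix≡0 =
    trans (sumℤ-split a b f) (trans (cong (_+ℤ sumℤ b (λ i → f (a + i))) (sumℤ-zero a f prefix≡0)) (ℤ.+-identityˡ _))

  sumℤ-comm : ∀ a b (f : ℕ → ℕ → ℤ) → sumℤ a (λ i → sumℤ b (f i)) ≡ sumℤ b (λ j → sumℤ a (λ i → f i j))
  sumℤ-comm zero b f = sym (sumℤ-zero b _ (λ _ _ → refl))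
  sumℤ-comm (suc a) b f = begin
    sumℤ a (λ i → sumℤ b (f i)) +ℤ sumℤ b (f a)          ≡⟨ cong (_+ℤ sumℤ b (f a)) (sumℤ-comm a b f) ⟩
    sumℤ b (λ j → sumℤ a (λ i → f i j)) +ℤ sumℤ b (f a)  ≡⟨ sym (sumℤ-+ b _ _) ⟩
    sumℤ b (λ j → sumℤ (suc a) (λ i → f i j))            ∎

  sumℤ-comm-weighted : ∀ K M (s c : ℕ → ℤ) (x : ℕ → ℕ → ℤ) →
    sumℤ K (λ j → s j *ℤ sumℤ M (λ i → c i *ℤ x j i)) ≡ sumℤ M (λ i → c i *ℤ sumℤ K (λ j → s j *ℤ x j i))
  sumℤ-comm-weighted K M s c x = begin
    sumℤ K (λ j → s j *ℤ sumℤ M (λ i → c i *ℤ x j i))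
      ≡⟨ sumℤ-cong K (λ j _ → sym (sumℤ-distribˡ M (s j) _)) ⟩
    sumℤ K (λ j → sumℤ M (λ i → s j *ℤ (c i *ℤ x j i)))
      ≡⟨ sumℤ-comm K M _ ⟩
    sumℤ M (λ i → sumℤ K (λ j → s j *ℤ (c i *ℤ x j i)))
      ≡⟨ sumℤ-cong M (λ i _ → sumℤ-cong K (λ j _ → swap (s j) (c i) (x j i))) ⟩
    sumℤ M (λ i → sumℤ K (λ j → c i *ℤ (s j *ℤ x j i)))
      ≡⟨ sumℤ-cong M (λ i _ → sumℤ-distribˡ K (c i) _) ⟩
    sumℤ M (λ i → c i *ℤ sumℤ K (λ j → s j *ℤ x j i)) ∎
    where
    swap : ∀ a b c → a *ℤ (b *ℤ c) ≡ b *ℤ (a *ℤ c)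
    swap = solve-∀

  ∣sumℤ : ∀ n d (f : ℕ → ℤ) → (∀ i → i < n → d ∣ℤ f i) → d ∣ℤ sumℤ n f
  ∣sumℤ zero d f h = divides (+ 0) refl
  ∣sumℤ (suc n) d f h = ∣m∣n⇒∣m+n (∣sumℤ n d f (below-suc h)) (h n ≤-refl)

  ∣sumℤ-sumℤ : ∀ n d (f g : ℕ → ℤ) → (∀ i → i < n → d ∣ℤ (f i -ℤ g i)) → d ∣ℤ (sumℤ n f -ℤ sumℤ n g)
  ∣sumℤ-sumℤ n d f g h = subst (d ∣ℤ_) (sumℤ-homo-− n) (∣sumℤ n d _ h)
    where
    sumℤ-homo-− : ∀ n → sumℤ n (λ i → f i -ℤ g i) ≡ sumℤ n f -ℤ sumℤ n g
    sumℤ-homo-− n = trans (sumℤ-+ n f (λ i → - g i)) (cong (sumℤ n f +ℤ_) (sumℤ-neg n g))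

  sumℤ-suc-difference : ∀ n (f g h : ℕ → ℤ) → h 0 ≡ f 0 → (∀ m → h (suc m) ≡ f (suc m) -ℤ g m) → f n ≡ + 0 →
                        sumℤ (suc n) h ≡ sumℤ n f -ℤ sumℤ n g
  sumℤ-suc-difference n f g h h₀ hₛ fₙ = begin
    sumℤ (suc n) h
      ≡⟨ sumℤ-head n h ⟩
    h 0 +ℤ sumℤ n (λ m → h (suc m))
      ≡⟨ cong₂ _+ℤ_ h₀ (sumℤ-cong n (λ m _ → hₛ m)) ⟩
    f 0 +ℤ sumℤ n (λ m → f (suc m) +ℤ - g m)
      ≡⟨ cong (f 0 +ℤ_) (sumℤ-+ n _ _) ⟩
    f 0 +ℤ (sumℤ n (λ m → f (suc m)) +ℤ sumℤ n (λ m → - g m))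
      ≡⟨ cong (λ s → f 0 +ℤ (sumℤ n (λ m → f (suc m)) +ℤ s)) (sumℤ-neg n g) ⟩
    f 0 +ℤ (sumℤ n (λ m → f (suc m)) +ℤ - sumℤ n g)
      ≡⟨ sym (ℤ.+-assoc (f 0) _ _) ⟩
    f 0 +ℤ sumℤ n (λ m → f (suc m)) -ℤ sumℤ n g
      ≡⟨ cong (_-ℤ sumℤ n g) (sym (sumℤ-head n f)) ⟩
    sumℤ (suc n) f -ℤ sumℤ n g
      ≡⟨ cong (λ v → sumℤ n f +ℤ v -ℤ sumℤ n g) fₙ ⟩
    sumℤ n f +ℤ + 0 -ℤ sumℤ n g
      ≡⟨ cong (_-ℤ sumℤ n g) (ℤ.+-identityʳ (sumℤ n f)) ⟩
    sumℤ n f -ℤ sumℤ n g ∎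

  binomialSum : ℕ → (ℕ → ℤ) → ℤ
  binomialSum k u = sumℤ (suc k) (λ i → sign i *ℤ (+ (k C i) *ℤ u i))

  binomialSum-suc : ∀ k u → binomialSum (suc k) u ≡ binomialSum k u -ℤ binomialSum k (λ i → u (suc i))
  binomialSum-suc k u = sumℤ-suc-difference (suc k) _ _ _ refl pascal
    (trans (cong (λ c → sign (suc k) *ℤ (+ c *ℤ u (suc k))) (k>n⇒nCk≡0 (n<1+n k))) (ℤ.*-zeroʳ (sign (suc k))))
    where
    pascal : ∀ i → sign (suc i) *ℤ (+ (suc k C suc i) *ℤ u (suc i))
                 ≡ sign (suc i) *ℤ (+ (k C suc i) *ℤ u (suc i)) -ℤ sign i *ℤ (+ (k C i) *ℤ u (suc i))
    pascal i rewrite sym (nCk+nC[k+1]≡[n+1]C[k+1] k i) | ℤ.pos-+ (k C i) (k C suc i) =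
      distrib (sign i) (+ (k C i)) (+ (k C suc i)) (u (suc i))
      where
      distrib : ∀ s a b v → - s *ℤ ((a +ℤ b) *ℤ v) ≡ - s *ℤ (b *ℤ v) -ℤ s *ℤ (a *ℤ v)
      distrib = solve-∀

module BinomialModPrime {p : ℕ} (p-prime : Prime p) where

  open import Data.Nat using (suc; _<_; s≤s; z≤n)
  open import Data.Nat.Combinatorics using (_C_; nCn≡1)
  open import Data.Integer using (ℤ; +_) renaming (_+_ to _+ℤ_; _*_ to _*ℤ_; _-_ to _-ℤ_)
  open import Data.Integer.Divisibility.Signed using (∣m∣n⇒∣m+n; ∣n⇒∣m*n; ∣m⇒∣m*n; ∣ᵤ⇒∣) renaming (_∣_ to _∣ℤ_)
  open import Data.Integer.Tactic.RingSolver using (solve-∀)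
  open import Relation.Binary.PropositionalEquality
  open Primes p-prime using (p>0; p∣pCk)
  open Signs using (p∣sign[p]+1)
  open Sums

  -- All inner binomial coefficients vanish mod p, and (-1)^p ≡ -1 mod p.
  p∣binomialSum[p]-[u₀-uₚ] : ∀ u → (+ p) ∣ℤ (binomialSum p u -ℤ (u 0 -ℤ u p))
  p∣binomialSum[p]-[u₀-uₚ] u = at p refl p>0
    where
    at : ∀ q → q ≡ p → 0 < q → (+ p) ∣ℤ (binomialSum q u -ℤ (u 0 -ℤ u q))
    at (suc p′) refl _ = subst ((+ p) ∣ℤ_) (sym difference)
      (∣m∣n⇒∣m+n (∣sumℤ p′ _ _ inner-divisible) (∣m⇒∣m*n (u p) (p∣sign[p]+1 p-prime)))
      where
      term : ℕ → ℤ
      term i = sign i *ℤ (+ (p C i) *ℤ u i)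
      inner : ℤ
      inner = sumℤ p′ (λ i → term (suc i))
      inner-divisible : ∀ i → i < p′ → (+ p) ∣ℤ term (suc i)
      inner-divisible i i<p′ = ∣n⇒∣m*n (sign (suc i))
        (∣m⇒∣m*n {m = + (p C suc i)} (u (suc i)) (∣ᵤ⇒∣ (p∣pCk (suc i) (s≤s z≤n) (s≤s i<p′))))
      difference : binomialSum p u -ℤ (u 0 -ℤ u p) ≡ inner +ℤ (sign p +ℤ + 1) *ℤ u p
      difference rewrite sumℤ-head p term | nCn≡1 p =
        regroup (u 0) inner (sign p) (u p)
        where
        regroup : ∀ a m s b → (+ 1 *ℤ (+ 1 *ℤ a) +ℤ (m +ℤ s *ℤ (+ 1 *ℤ b))) -ℤ (a -ℤ b) ≡ m +ℤ (s +ℤ + 1) *ℤ b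
        regroup = solve-∀

module GroupLemmas {c ℓ : Level} (G : FiniteAbelianGroup c ℓ) where

  open import Data.Nat using (zero; suc; _+_; _*_)
  open import Relation.Binary.PropositionalEquality using (_≡_)
  import Relation.Binary.PropositionalEquality as ≡
  open FiniteAbelianGroup G public
  open import Algebra.Properties.AbelianGroup abelianGroup public
    using (ε⁻¹≈ε; ⁻¹-∙-comm; inverseʳ-unique; //-rightDividesˡ; //-rightDividesʳ; //-cong₂)
  open import Algebra.Properties.CommutativeSemigroup commutativeSemigroup using (interchange)
  open import Relation.Binary.Reasoning.Setoid setoid

  infixr 8 _·_
  _·_ : ℕ → Carrier → Carrier
  _·_ = Defs._·_ G

  ·-congʳ : ∀ m {x y} → x ≈ y → m · x ≈ m · y
  ·-congʳ zero eq = refl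
  ·-congʳ (suc m) eq = ∙-cong eq (·-congʳ m eq)

  ·-congˡ : ∀ {m n} x → m ≡ n → m · x ≈ n · x
  ·-congˡ x ≡.refl = refl

  ·-homo-1 : ∀ x → 1 · x ≈ x
  ·-homo-1 = identityʳ

  ·-homo-+ : ∀ x m n → (m + n) · x ≈ m · x ∙ n · x
  ·-homo-+ x zero n = sym (identityˡ _)
  ·-homo-+ x (suc m) n = begin
    x ∙ (m + n) · x        ≈⟨ ∙-cong refl (·-homo-+ x m n) ⟩
    x ∙ (m · x ∙ n · x)    ≈⟨ sym (assoc _ _ _) ⟩
    (x ∙ m · x) ∙ n · x    ∎

  ·-homo-* : ∀ x m n → (m * n) · x ≈ m · (n · x)
  ·-homo-* x zero n = refl
  ·-homo-* x (suc m) n = trans (·-homo-+ x n (m * n)) (∙-cong refl (·-homo-* x m n))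

  ·-ε : ∀ m → m · ε ≈ ε
  ·-ε zero = refl
  ·-ε (suc m) = trans (identityˡ _) (·-ε m)

  x-ε≈x : ∀ x → x - ε ≈ x
  x-ε≈x x = trans (∙-cong refl ε⁻¹≈ε) (identityʳ x)

  [x-y]∙y≈x : ∀ x y → (x - y) ∙ y ≈ x
  [x-y]∙y≈x x y = //-rightDividesˡ y x

  [x∙y]-y≈x : ∀ x y → (x ∙ y) - y ≈ x
  [x∙y]-y≈x x y = //-rightDividesʳ y x

  x∙[y-x]≈y : ∀ x y → x ∙ (y - x) ≈ y
  x∙[y-x]≈y x y = trans (comm _ _) ([x-y]∙y≈x y x)

  x-[y∙z]≈x-y-z : ∀ x y z → x - (y ∙ z) ≈ (x - y) - z
  x-[y∙z]≈x-y-z x y z = begin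
    x ∙ (y ∙ z) ⁻¹       ≈⟨ ∙-cong refl (sym (⁻¹-∙-comm y z)) ⟩
    x ∙ (y ⁻¹ ∙ z ⁻¹)    ≈⟨ sym (assoc _ _ _) ⟩
    (x ∙ y ⁻¹) ∙ z ⁻¹    ∎

  -‿swap : ∀ x y z → (x - y) - z ≈ (x - z) - y
  -‿swap x y z = begin
    (x - y) - z    ≈⟨ sym (x-[y∙z]≈x-y-z x y z) ⟩
    x - (y ∙ z)    ≈⟨ //-cong₂ refl (comm y z) ⟩
    x - (z ∙ y)    ≈⟨ x-[y∙z]≈x-y-z x z y ⟩
    (x - z) - y    ∎

  -‿distrib-∙ : ∀ x y u v → (x - u) ∙ (y - v) ≈ (x ∙ y) - (u ∙ v)
  -‿distrib-∙ x y u v = trans (interchange _ _ _ _) (∙-cong refl (⁻¹-∙-comm u v))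

  ≈∙⇒-≈ : ∀ {x y z} → x ≈ y ∙ z → x - z ≈ y
  ≈∙⇒-≈ {x} {y} {z} eq = trans (∙-cong eq refl) ([x∙y]-y≈x y z)

  ∙-cancelˡ : ∀ {a x y} → a ∙ x ≈ a ∙ y → x ≈ y
  ∙-cancelˡ {a} {x} {y} eq = begin
    x              ≈⟨ sym ([x∙y]-y≈x x a) ⟩
    (x ∙ a) - a    ≈⟨ //-cong₂ (trans (comm x a) (trans eq (comm a y))) refl ⟩
    (y ∙ a) - a    ≈⟨ [x∙y]-y≈x y a ⟩
    y              ∎

module FiniteDifferences {c ℓ : Level} (G : FiniteAbelianGroup c ℓ) where

  open import Level using (_⊔_)
  open import Data.Nat using (zero; suc; _+_; _*_; _^_)
  open import Data.Nat.Combinatorics using (_C_)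
  open import Data.Integer using (ℤ; +_; -_) renaming (_+_ to _+ℤ_; _*_ to _*ℤ_; _-_ to _-ℤ_)
  import Data.Integer.Properties as ℤ
  open import Data.Integer.Divisibility.Signed
    using (divides; ∣m∣n⇒∣m+n; ∣m∣n⇒∣m-n) renaming (_∣_ to _∣ℤ_)
  open import Data.Integer.Tactic.RingSolver using (solve-∀)
  open import Data.List using (List; []; _∷_; _++_; replicate)
  open import Relation.Binary.PropositionalEquality
    renaming (refl to ≡-refl; sym to ≡-sym; trans to ≡-trans) hiding ([_])
  open GroupLemmas G
  open Sums

  Fn : Set c
  Fn = Carrier → ℤ

  Respectful : Fn → Set (c ⊔ ℓ)
  Respectful F = ∀ {x y} → x ≈ y → F x ≡ F y

  Δ : Carrier → Fn → Fn
  Δ y F x = F x -ℤ F (x - y)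

  Δ* : List Carrier → Fn → Fn
  Δ* [] F = F
  Δ* (y ∷ ys) F = Δ y (Δ* ys F)

  Δ-respectful : ∀ y {F} → Respectful F → Respectful (Δ y F)
  Δ-respectful y resp eq = cong₂ _-ℤ_ (resp eq) (resp (//-cong₂ eq refl))

  Δ*-respectful : ∀ ys {F} → Respectful F → Respectful (Δ* ys F)
  Δ*-respectful [] resp = resp
  Δ*-respectful (y ∷ ys) resp = Δ-respectful y (Δ*-respectful ys resp)

  Δ-cong : ∀ y {F F′} → (∀ x → F x ≡ F′ x) → ∀ x → Δ y F x ≡ Δ y F′ x
  Δ-cong y h x = cong₂ _-ℤ_ (h x) (h (x - y))

  Δ*-cong : ∀ ys {F F′} → (∀ x → F x ≡ F′ x) → ∀ x → Δ* ys F x ≡ Δ* ys F′ x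
  Δ*-cong [] h = h
  Δ*-cong (y ∷ ys) h = Δ-cong y (Δ*-cong ys h)

  Δ-congˡ : ∀ {F} → Respectful F → ∀ {y y′} → y ≈ y′ → ∀ x → Δ y F x ≡ Δ y′ F x
  Δ-congˡ {F} resp eq x = cong (F x -ℤ_) (resp (//-cong₂ refl eq))

  Δ-comm : ∀ {F} → Respectful F → ∀ y z x → Δ y (Δ z F) x ≡ Δ z (Δ y F) x
  Δ-comm {F} resp y z x = ≡-trans
    (cong (λ w → (F x -ℤ F (x - z)) -ℤ (F (x - y) -ℤ w)) (resp (-‿swap x y z)))
    (exchange (F x) (F (x - z)) (F (x - y)) (F ((x - z) - y)))
    where
    exchange : ∀ a b c d → (a -ℤ b) -ℤ (c -ℤ d) ≡ (a -ℤ c) -ℤ (b -ℤ d)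
    exchange = solve-∀

  Δ-Δ*-comm : ∀ {F} → Respectful F → ∀ y zs x → Δ y (Δ* zs F) x ≡ Δ* zs (Δ y F) x
  Δ-Δ*-comm resp y [] x = ≡-refl
  Δ-Δ*-comm resp y (z ∷ zs) x =
    ≡-trans (Δ-comm (Δ*-respectful zs resp) y z x) (Δ-cong z (Δ-Δ*-comm resp y zs) x)

  Δ*-comm : ∀ {F} → Respectful F → ∀ ys zs x → Δ* ys (Δ* zs F) x ≡ Δ* zs (Δ* ys F) x
  Δ*-comm resp [] zs x = ≡-refl
  Δ*-comm resp (y ∷ ys) zs x =
    ≡-trans (Δ-cong y (Δ*-comm resp ys zs) x) (Δ-Δ*-comm (Δ*-respectful ys resp) y zs x)

  Δ*-++ : ∀ ys zs F x → Δ* (ys ++ zs) F x ≡ Δ* ys (Δ* zs F) x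
  Δ*-++ [] zs F x = ≡-refl
  Δ*-++ (y ∷ ys) zs F x = Δ-cong y (Δ*-++ ys zs F) x

  Δ*-+ : ∀ ys (F F′ : Fn) x → Δ* ys (λ z → F z +ℤ F′ z) x ≡ Δ* ys F x +ℤ Δ* ys F′ x
  Δ*-+ [] F F′ x = ≡-refl
  Δ*-+ (y ∷ ys) F F′ x =
    ≡-trans (cong₂ _-ℤ_ (Δ*-+ ys F F′ x) (Δ*-+ ys F F′ (x - y))) (exchange (Δ* ys F x) (Δ* ys F′ x) _ _)
    where
    exchange : ∀ a b c d → (a +ℤ b) -ℤ (c +ℤ d) ≡ (a -ℤ c) +ℤ (b -ℤ d)
    exchange = solve-∀

  Δ*-neg : ∀ ys (F : Fn) x → Δ* ys (λ z → - F z) x ≡ - Δ* ys F x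
  Δ*-neg [] F x = ≡-refl
  Δ*-neg (y ∷ ys) F x =
    ≡-trans (cong₂ _-ℤ_ (Δ*-neg ys F x) (Δ*-neg ys F (x - y))) (neg-distrib (Δ* ys F x) _)
    where
    neg-distrib : ∀ a b → (- a) -ℤ (- b) ≡ - (a -ℤ b)
    neg-distrib = solve-∀

  Δ*-homo-− : ∀ ys (F F′ : Fn) x → Δ* ys (λ z → F z -ℤ F′ z) x ≡ Δ* ys F x -ℤ Δ* ys F′ x
  Δ*-homo-− ys F F′ x = ≡-trans (Δ*-+ ys F (λ z → - F′ z) x) (cong (Δ* ys F x +ℤ_) (Δ*-neg ys F′ x))

  -- The group-ring identity 1 - ab = (1 - a) + (1 - b) - (1 - a)(1 - b).
  Δ-∙ : ∀ {F} → Respectful F → ∀ {y a b} → y ≈ a ∙ b → ∀ x →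
        Δ y F x ≡ (Δ a F x +ℤ Δ b F x) -ℤ Δ a (Δ b F) x
  Δ-∙ {F} resp {y} {a} {b} eq x = ≡-trans
    (cong (F x -ℤ_) (resp (trans (//-cong₂ refl eq) (x-[y∙z]≈x-y-z x a b))))
    (expand (F x) (F (x - a)) (F (x - b)) (F ((x - a) - b)))
    where
    expand : ∀ a′ b′ c′ d → a′ -ℤ d ≡ ((a′ -ℤ b′) +ℤ (a′ -ℤ c′)) -ℤ ((a′ -ℤ c′) -ℤ (b′ -ℤ d))
    expand = solve-∀

  infix 4 _∣ᶠ_
  record _∣ᶠ_ (d : ℤ) (F : Fn) : Set c where
    constructor ∣ᶠ-at
    field at : ∀ x → d ∣ℤ F x
  open _∣ᶠ_ public

  record _≡ᶠ_[mod_] (F F′ : Fn) (d : ℤ) : Set c where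
    constructor ≡ᶠ-at
    field differs-at : ∀ x → d ∣ℤ (F x -ℤ F′ x)
  open _≡ᶠ_[mod_] public

  ∣ᶠ-cong : ∀ {d F F′} → (∀ x → F x ≡ F′ x) → d ∣ᶠ F′ → d ∣ᶠ F
  ∣ᶠ-cong {d} eq d∣F′ = ∣ᶠ-at λ x → subst (d ∣ℤ_) (≡-sym (eq x)) (at d∣F′ x)

  Δ*-∣ᶠ : ∀ {d} ys {F} → d ∣ᶠ F → d ∣ᶠ Δ* ys F
  Δ*-∣ᶠ [] d∣F = d∣F
  Δ*-∣ᶠ (y ∷ ys) d∣F = ∣ᶠ-at λ x → ∣m∣n⇒∣m-n (at (Δ*-∣ᶠ ys d∣F) x) (at (Δ*-∣ᶠ ys d∣F) (x - y))

  Δ*-≡ᶠ : ∀ {d} ys {F F′} → F ≡ᶠ F′ [mod d ] → Δ* ys F ≡ᶠ Δ* ys F′ [mod d ]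
  Δ*-≡ᶠ ys {F} {F′} F≡F′ = ≡ᶠ-at (at (∣ᶠ-cong (λ x → ≡-sym (Δ*-homo-− ys F F′ x)) (Δ*-∣ᶠ ys (∣ᶠ-at (differs-at F≡F′)))))

  ≡ᶠ-refl : ∀ {d F F′} → (∀ x → F x ≡ F′ x) → F ≡ᶠ F′ [mod d ]
  ≡ᶠ-refl {d} {F} {F′} eq = ≡ᶠ-at λ x → subst (d ∣ℤ_) (≡-sym (≡-trans (cong (F x -ℤ_) (≡-sym (eq x))) (ℤ.+-inverseʳ (F x))))
    (divides (+ 0) ≡-refl)

  ≡ᶠ-trans : ∀ {d F} F′ {F″} → F ≡ᶠ F′ [mod d ] → F′ ≡ᶠ F″ [mod d ] → F ≡ᶠ F″ [mod d ]
  ≡ᶠ-trans {d} {F} F′ {F″} h₁ h₂ = ≡ᶠ-at λ x →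
    subst (d ∣ℤ_) (telescope (F x) (F′ x) (F″ x)) (∣m∣n⇒∣m+n (differs-at h₁ x) (differs-at h₂ x))
    where
    telescope : ∀ a b c → (a -ℤ b) +ℤ (b -ℤ c) ≡ a -ℤ c
    telescope = solve-∀

  ≡ᶠ-∣ᶠ : ∀ {d F F′} → F ≡ᶠ F′ [mod d ] → d ∣ᶠ F′ → d ∣ᶠ F
  ≡ᶠ-∣ᶠ {d} {F} {F′} F≡F′ d∣F′ = ∣ᶠ-at λ x →
    subst (d ∣ℤ_) (cancel (F x) (F′ x)) (∣m∣n⇒∣m+n (differs-at F≡F′ x) (at d∣F′ x))
    where
    cancel : ∀ a b → (a -ℤ b) +ℤ b ≡ a
    cancel = solve-∀

  Δ*-replicate : ∀ {F} → Respectful F → ∀ y k x → Δ* (replicate k y) F x ≡ binomialSum k (λ i → F (x - i · y))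
  Δ*-replicate {F} resp y zero x = ≡-trans (resp (sym (x-ε≈x x))) (unit (F (x - ε)))
    where
    unit : ∀ a → a ≡ + 0 +ℤ + 1 *ℤ (+ 1 *ℤ a)
    unit = solve-∀
  Δ*-replicate {F} resp y (suc k) x = begin
    Δ* (replicate k y) F x -ℤ Δ* (replicate k y) F (x - y)
      ≡⟨ cong₂ _-ℤ_ (Δ*-replicate resp y k x) (Δ*-replicate resp y k (x - y)) ⟩
    binomialSum k (λ i → F (x - i · y)) -ℤ binomialSum k (λ i → F ((x - y) - i · y))
      ≡⟨ cong (binomialSum k (λ i → F (x - i · y)) -ℤ_) (sumℤ-cong (suc k) (λ i _ → cong (λ v → sign i *ℤ (+ (k C i) *ℤ v))
           (resp (sym (x-[y∙z]≈x-y-z x y (i · y)))))) ⟩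
    binomialSum k (λ i → F (x - i · y)) -ℤ binomialSum k (λ i → F (x - suc i · y))
      ≡⟨ ≡-sym (binomialSum-suc k (λ i → F (x - i · y))) ⟩
    binomialSum (suc k) (λ i → F (x - i · y)) ∎
    where open ≡-Reasoning

  module _ {p : ℕ} (p-prime : Prime p) where

    open BinomialModPrime p-prime

    frobenius : ∀ {F} → Respectful F → ∀ y → Δ* (replicate p y) F ≡ᶠ Δ (p · y) F [mod + p ]
    frobenius {F} resp y = ≡ᶠ-at λ x → subst ((+ p) ∣ℤ_)
      (cong₂ (λ a b → a -ℤ (b -ℤ F (x - p · y))) (≡-sym (Δ*-replicate resp y p x)) (resp (x-ε≈x x)))
      (p∣binomialSum[p]-[u₀-uₚ] (λ i → F (x - i · y)))

    replicate-+ : ∀ a b (y : Carrier) → replicate (a + b) y ≡ replicate a y ++ replicate b y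
    replicate-+ zero b y = ≡-refl
    replicate-+ (suc a) b y = cong (y ∷_) (replicate-+ a b y)

    Δ*-replicate-* : ∀ k y z → (∀ {F} → Respectful F → Δ* (replicate k y) F ≡ᶠ Δ z F [mod + p ]) →
      ∀ m {F} → Respectful F → Δ* (replicate (m * k) y) F ≡ᶠ Δ* (replicate m z) F [mod + p ]
    Δ*-replicate-* k y z hyp zero resp = ≡ᶠ-refl (λ _ → ≡-refl)
    Δ*-replicate-* k y z hyp (suc m) {F} resp =
      ≡ᶠ-trans (Δ* (replicate k y) (Δ* (replicate (m * k) y) F))
        (≡ᶠ-refl (λ x → ≡-trans (cong (λ ys → Δ* ys F x) (replicate-+ k (m * k) y)) (Δ*-++ (replicate k y) _ F x)))
        (≡ᶠ-trans (Δ z (Δ* (replicate (m * k) y) F)) (hyp (Δ*-respectful (replicate (m * k) y) resp))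
          (Δ*-≡ᶠ (z ∷ []) (Δ*-replicate-* k y z hyp m resp)))

    frobenius-^ : ∀ a {F} → Respectful F → ∀ y → Δ* (replicate (p ^ a) y) F ≡ᶠ Δ ((p ^ a) · y) F [mod + p ]
    frobenius-^ zero resp y = ≡ᶠ-refl (Δ-congˡ resp (sym (·-homo-1 y)))
    frobenius-^ (suc a) {F} resp y =
      ≡ᶠ-trans (Δ* (replicate p ((p ^ a) · y)) F)
        (Δ*-replicate-* (p ^ a) y ((p ^ a) · y) (λ resp′ → frobenius-^ a resp′ y) p resp)
        (≡ᶠ-trans (Δ (p · ((p ^ a) · y)) F) (frobenius resp ((p ^ a) · y))
          (≡ᶠ-refl (Δ-congˡ resp (sym (·-homo-* y p (p ^ a))))))

    Δ*-replicate-order : ∀ a {F} → Respectful F → ∀ g → (p ^ a) · g ≈ ε → (+ p) ∣ᶠ Δ* (replicate (p ^ a) g) F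
    Δ*-replicate-order a {F} resp g p^a·g≈ε = ≡ᶠ-∣ᶠ (frobenius-^ a resp g) (∣ᶠ-at λ x →
      subst ((+ p) ∣ℤ_) (≡-sym (≡-trans (cong (F x -ℤ_) (resp (trans (//-cong₂ refl p^a·g≈ε) (x-ε≈x x))))
        (ℤ.+-inverseʳ (F x)))) (divides (+ 0) ≡-refl))

module Olson where

  open import Level using (_⊔_)
  open import Data.Nat using (zero; suc; _+_; _∸_; _^_; _≤_; _<_; z≤n; s≤s; _≤?_; >-nonZero)
  import Data.Nat.Properties as ℕ
  import Data.Nat.Tactic.RingSolver as ℕ-Solver
  open import Data.Integer using (ℤ; +_) renaming (_-_ to _-ℤ_; _+_ to _+ℤ_)
  import Data.Integer.Properties as ℤ
  open import Data.Integer.Divisibility.Signed using (∣m∣n⇒∣m+n; ∣m∣n⇒∣m-n) renaming (_∣_ to _∣ℤ_)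
  open import Data.Integer.Tactic.RingSolver using (solve-∀)
  open import Data.List using (List; []; _∷_; replicate; length; map)
  open import Data.Vec as Vec using (Vec)
  open import Data.Fin using (zero; suc)
  open import Data.Fin.Subset using (Subset; ∣_∣; Nonempty; inside; outside)
  open import Data.Fin.Subset.Properties using (∣p∣≤n)
  open import Data.Product using (∃; _×_; _,_)
  open import Data.Sum using (_⊎_; inj₁; inj₂)
  open import Relation.Nullary using (¬_; yes; no)
  open import Relation.Binary.PropositionalEquality
    using (_≡_; cong; cong₂; subst) renaming (refl to ≡-refl; sym to ≡-sym; trans to ≡-trans)
  open Defs using (subSum; HasZeroSum)

  Nonempty-++ : ∀ {m n} (I : Subset m) (J : Subset n) → Nonempty (I Vec.++ J) → Nonempty I ⊎ Nonempty J
  Nonempty-++ Vec.[] J ne = inj₂ ne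
  Nonempty-++ (b Vec.∷ I) J (zero , Vec.here) = inj₁ (zero , Vec.here)
  Nonempty-++ (b Vec.∷ I) J (suc i , Vec.there i∈) with Nonempty-++ I J (i , i∈)
  ... | inj₁ (i′ , i′∈) = inj₁ (suc i′ , Vec.there i′∈)
  ... | inj₂ neJ = inj₂ neJ

  ∣I∣≡0⇒¬Nonempty : ∀ {m} (I : Subset m) → ∣ I ∣ ≡ 0 → ¬ Nonempty I
  ∣I∣≡0⇒¬Nonempty (inside Vec.∷ I) () ne
  ∣I∣≡0⇒¬Nonempty (outside Vec.∷ I) eq (suc i , Vec.there i∈) = ∣I∣≡0⇒¬Nonempty I eq (i , i∈)

  module _ {c ℓ : Level} (G : FiniteAbelianGroup c ℓ) where

    open GroupLemmas G using (Carrier; _≈_; _∙_; refl; sym; trans; ∙-cong; assoc; identityˡ)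
    open FiniteDifferences G

    subSum-++ : ∀ {m n} (I : Subset m) (J : Subset n) X Y →
                subSum G (I Vec.++ J) (X Vec.++ Y) ≈ subSum G I X ∙ subSum G J Y
    subSum-++ Vec.[] J Vec.[] Y = sym (identityˡ _)
    subSum-++ (inside Vec.∷ I) J (x Vec.∷ X) Y = trans (∙-cong refl (subSum-++ I J X Y)) (sym (assoc _ _ _))
    subSum-++ (outside Vec.∷ I) J (x Vec.∷ X) Y = subSum-++ I J X Y

    DifferencesVanishAbove : ℕ → ℕ → Set (c ⊔ ℓ)
    DifferencesVanishAbove p w = ∀ ys → w < length ys → ∀ F → Respectful F → (+ p) ∣ᶠ Δ* ys F

    ZeroSumFreeOfLength : ℕ → Set (c ⊔ ℓ)
    ZeroSumFreeOfLength w = ∃ λ (X : Vec Carrier w) → ¬ HasZeroSum G X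

    zeroSumFree⇒<D : ∀ {w D} → Defs.IsDavenport G D → ZeroSumFreeOfLength w → w < D
    zeroSumFree⇒<D {w} (_ , zeroSum , _) (X , free) = ℕ.≰⇒> (λ D≤w → free (zeroSum w D≤w X))

  module _ {p : ℕ} (p-prime : Prime p) {c ℓ c′ ℓ′ : Level}
           (G : FiniteAbelianGroup c ℓ) (H : FiniteAbelianGroup c′ ℓ′) where

    private module H = GroupLemmas H
    open GroupLemmas G
    open FiniteDifferences G
    private module ΔH = FiniteDifferences H
    open Primes p-prime using (p^e>0)
    open Sums using (∣sumℤ)

    -- G = ⟨g⟩ ⊕ ι(H) with g of order p ^ a.
    record CyclicSplitting : Set (c ⊔ ℓ ⊔ c′ ⊔ ℓ′) where
      field
        g : Carrier
        a : ℕ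
        g-order : (p ^ a) · g ≈ ε
        ι : H.Carrier → Carrier
        ι-cong : ∀ {x y} → x H.≈ y → ι x ≈ ι y
        ι-∙ : ∀ x y → ι (x H.∙ y) ≈ ι x ∙ ι y
        decompose : ∀ x → ∃ λ k → ∃ λ y → x ≈ (k · g) ∙ ι y
        independent : ∀ k y → k < p ^ a → (k · g) ∙ ι y ≈ ε → (k ≡ 0) × (y H.≈ H.ε)

    module _ (S : CyclicSplitting) where

      open CyclicSplitting S

      private
        q : ℕ
        q = p ^ a

      ι-ε : ι H.ε ≈ ε
      ι-ε = ∙-cancelˡ (trans (sym (ι-∙ H.ε H.ε)) (trans (ι-cong (H.identityˡ H.ε)) (sym (identityʳ _))))

      ι-homo-− : ∀ x y → ι (x H.- y) ≈ ι x - ι y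
      ι-homo-− x y = sym (≈∙⇒-≈ (trans (ι-cong (H.sym (H.[x-y]∙y≈x x y))) (ι-∙ _ _)))

      multiplesOfg : List ℕ → List Carrier
      multiplesOfg = map (_· g)

      Δ*-ι : ∀ ys {F} → Respectful F → ∀ x y → Δ* (map ι ys) F (x ∙ ι y) ≡ ΔH.Δ* ys (λ z → F (x ∙ ι z)) y
      Δ*-ι [] resp x y = ≡-refl
      Δ*-ι (k ∷ ys) {F} resp x y =
        cong₂ _-ℤ_ (Δ*-ι ys resp x y) (≡-trans (Δ*-respectful (map ι ys) resp coset) (Δ*-ι ys resp x (y H.- k)))
        where
        coset : (x ∙ ι y) - ι k ≈ x ∙ ι (y H.- k)
        coset = trans (assoc _ _ _) (∙-cong refl (sym (ι-homo-− y k)))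

      Δ-multiple : ∀ {F} → Respectful F → ∀ k x → Δ (k · g) F x ≡ sumℤ k (λ i → Δ g F (x - i · g))
      Δ-multiple {F} resp zero x = ≡-trans (cong (F x -ℤ_) (resp (x-ε≈x x))) (ℤ.+-inverseʳ (F x))
      Δ-multiple {F} resp (suc k) x = ≡-trans
        (cong (F x -ℤ_) (resp (trans (x-[y∙z]≈x-y-z x g (k · g)) (-‿swap x g (k · g)))))
        (≡-trans (telescope (F x) (F (x - k · g)) (F ((x - k · g) - g)))
          (cong (_+ℤ Δ g F (x - k · g)) (Δ-multiple resp k x)))
        where
        telescope : ∀ a b c → a -ℤ c ≡ (a -ℤ b) +ℤ (b -ℤ c)
        telescope = solve-∀

      -- Δ (c · g) is a sum of translates of Δ g, so divisibility of Δ g ^ k passes to any k factors Δ (c · g).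
      Δ*-multiples : ∀ cs {F} → Respectful F → ∀ k → (+ p) ∣ᶠ Δ* (replicate k g) F → k ≤ length cs →
                     (+ p) ∣ᶠ Δ* (multiplesOfg cs) F
      Δ*-multiples [] resp .0 p∣ z≤n = p∣
      Δ*-multiples (c ∷ cs) resp zero p∣ _ = Δ*-∣ᶠ (multiplesOfg (c ∷ cs)) p∣
      Δ*-multiples (c ∷ cs) {F} resp (suc k) p∣ (s≤s k≤) = ∣ᶠ-at λ x →
        subst ((+ p) ∣ℤ_) (≡-sym (Δ-multiple (Δ*-respectful (multiplesOfg cs) resp) c x))
          (∣sumℤ c (+ p) _ (λ i _ → subst ((+ p) ∣ℤ_) (≡-sym (Δ-Δ*-comm resp g (multiplesOfg cs) (x - i · g)))
            (at shifted (x - i · g))))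
        where
        shifted : (+ p) ∣ᶠ Δ* (multiplesOfg cs) (Δ g F)
        shifted = Δ*-multiples cs (Δ-respectful g resp) k
          (∣ᶠ-cong (λ x → ≡-sym (Δ-Δ*-comm resp g (replicate k g) x)) p∣) k≤

      module _ (w : ℕ) (vanishH : DifferencesVanishAbove H p w) where

        Δ*-ι-vanishes : ∀ ys → w < length ys → ∀ {F} → Respectful F → (+ p) ∣ᶠ Δ* (map ι ys) F
        Δ*-ι-vanishes ys w<ys {F} resp = ∣ᶠ-at λ x → subst ((+ p) ∣ℤ_)
          (≡-sym (≡-trans (Δ*-respectful (map ι ys) resp (sym (trans (∙-cong refl ι-ε) (identityʳ x))))
            (Δ*-ι ys resp x H.ε)))
          (ΔH.at (vanishH ys w<ys (λ z → F (x ∙ ι z)) (λ eq → resp (∙-cong refl (ι-cong eq)))) H.ε)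

        -- Expanding each Δ x along x = k · g ∙ ι y moves it into either the ⟨g⟩- or the H-part.
        Δ*-split-vanishes : ∀ xs cs ys → q + w ≤ length xs + length cs + length ys → ∀ {F} → Respectful F →
                            (+ p) ∣ᶠ Δ* xs (Δ* (multiplesOfg cs) (Δ* (map ι ys) F))
        Δ*-split-vanishes [] cs ys bound {F} resp with q ≤? length cs
        ... | yes q≤cs = Δ*-multiples cs (Δ*-respectful (map ι ys) resp) q
                           (Δ*-replicate-order p-prime a (Δ*-respectful (map ι ys) resp) g g-order) q≤cs
        ... | no q≰cs = ∣ᶠ-cong (λ x → Δ*-comm resp (multiplesOfg cs) (map ι ys) x)
                         (Δ*-ι-vanishes ys (ℕ.+-cancelˡ-< (length cs) _ _
                           (ℕ.<-≤-trans (ℕ.+-monoˡ-< w (ℕ.≰⇒> q≰cs)) bound)) (Δ*-respectful (multiplesOfg cs) resp))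
        Δ*-split-vanishes (x ∷ xs) cs ys bound {F} resp with decompose x
        ... | k , y , x≈kg∙ιy = ∣ᶠ-cong expand (∣ᶠ-at λ z →
              ∣m∣n⇒∣m-n (∣m∣n⇒∣m+n (at viaG z) (at viaH z)) (at viaBoth z))
          where
          moveG : ∀ l m n → suc l + m + n ≡ l + suc m + n
          moveG = ℕ-Solver.solve-∀
          moveH : ∀ l m n → suc l + m + n ≡ l + m + suc n
          moveH = ℕ-Solver.solve-∀
          moveBoth : ∀ l m n → suc l + m + n ≤ l + suc m + suc n
          moveBoth l m n = ℕ.≤-trans (ℕ.≤-reflexive (moveG l m n)) (ℕ.+-monoʳ-≤ (l + suc m) (ℕ.n≤1+n n))
          Φ : Fn
          Φ = Δ* (multiplesOfg cs) (Δ* (map ι ys) F)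
          Φ-resp : Respectful Φ
          Φ-resp = Δ*-respectful (multiplesOfg cs) (Δ*-respectful (map ι ys) resp)
          Διy-Φ : ∀ w → Δ (ι y) Φ w ≡ Δ* (multiplesOfg cs) (Δ* (map ι (y ∷ ys)) F) w
          Διy-Φ w = Δ-Δ*-comm (Δ*-respectful (map ι ys) resp) (ι y) (multiplesOfg cs) w
          viaG : (+ p) ∣ᶠ Δ* xs (Δ (k · g) Φ)
          viaG = Δ*-split-vanishes xs (k ∷ cs) ys (subst (q + w ≤_) (moveG (length xs) (length cs) (length ys)) bound) resp
          viaH : (+ p) ∣ᶠ Δ* xs (Δ (ι y) Φ)
          viaH = ∣ᶠ-cong (Δ*-cong xs Διy-Φ)
            (Δ*-split-vanishes xs cs (y ∷ ys) (subst (q + w ≤_) (moveH (length xs) (length cs) (length ys)) bound) resp)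
          viaBoth : (+ p) ∣ᶠ Δ* xs (Δ (k · g) (Δ (ι y) Φ))
          viaBoth = ∣ᶠ-cong (Δ*-cong xs (Δ-cong (k · g) Διy-Φ))
            (Δ*-split-vanishes xs (k ∷ cs) (y ∷ ys) (ℕ.≤-trans bound (moveBoth (length xs) (length cs) (length ys))) resp)
          expand : ∀ z → Δ x (Δ* xs Φ) z
                       ≡ (Δ* xs (Δ (k · g) Φ) z +ℤ Δ* xs (Δ (ι y) Φ) z) -ℤ Δ* xs (Δ (k · g) (Δ (ι y) Φ)) z
          expand z = ≡-trans (Δ-Δ*-comm Φ-resp x xs z)
            (≡-trans (Δ*-cong xs (Δ-∙ Φ-resp x≈kg∙ιy) z)
              (≡-trans (Δ*-homo-− xs (λ w → Δ (k · g) Φ w +ℤ Δ (ι y) Φ w) (Δ (k · g) (Δ (ι y) Φ)) z)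
                (cong (_-ℤ Δ* xs (Δ (k · g) (Δ (ι y) Φ)) z) (Δ*-+ xs (Δ (k · g) Φ) (Δ (ι y) Φ) z))))
        differencesVanish : DifferencesVanishAbove G p (q ∸ 1 + w)
        differencesVanish xs bound F resp = Δ*-split-vanishes xs [] [] q+w≤ resp
          where
          q+w≤ : q + w ≤ length xs + 0 + 0
          q+w≤ rewrite ℕ.+-identityʳ (length xs) | ℕ.+-identityʳ (length xs) | ≡-sym (ℕ.suc-pred q {{>-nonZero (p^e>0 a)}}) = bound

      subSum-replicate : ∀ {m} (I : Subset m) → subSum G I (Vec.replicate m g) ≈ ∣ I ∣ · g
      subSum-replicate Vec.[] = refl
      subSum-replicate (inside Vec.∷ I) = ∙-cong refl (subSum-replicate I)
      subSum-replicate (outside Vec.∷ I) = subSum-replicate I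

      subSum-ι : ∀ {m} (I : Subset m) (Y : Vec H.Carrier m) → subSum G I (Vec.map ι Y) ≈ ι (subSum H I Y)
      subSum-ι Vec.[] Vec.[] = sym ι-ε
      subSum-ι (inside Vec.∷ I) (y Vec.∷ Y) = trans (∙-cong refl (subSum-ι I Y)) (sym (ι-∙ _ _))
      subSum-ι (outside Vec.∷ I) (y Vec.∷ Y) = subSum-ι I Y

      -- (q ∸ 1) copies of g followed by the image of a zero-sum-free sequence of H.
      zeroSumFree : ∀ w → ZeroSumFreeOfLength H w → ZeroSumFreeOfLength G (q ∸ 1 + w)
      zeroSumFree w (Y , Y-free) = Vec.replicate (q ∸ 1) g Vec.++ Vec.map ι Y , free
        where
        free : ¬ HasZeroSum G (Vec.replicate (q ∸ 1) g Vec.++ Vec.map ι Y)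
        free (I , ne , sum≈ε) with Vec.splitAt (q ∸ 1) I
        ... | I₁ , I₂ , ≡-refl with independent ∣ I₁ ∣ (subSum H I₂ Y) ∣I₁∣<q sum≈ε′ | Nonempty-++ I₁ I₂ ne
          where
          sum≈ε′ : (∣ I₁ ∣ · g) ∙ ι (subSum H I₂ Y) ≈ ε
          sum≈ε′ = trans (sym (∙-cong (subSum-replicate I₁) (subSum-ι I₂ Y))) (trans (sym (subSum-++ G I₁ I₂ _ _)) sum≈ε)
          ∣I₁∣<q : ∣ I₁ ∣ < q
          ∣I₁∣<q = ℕ.≤-<-trans (∣p∣≤n I₁) (ℕ.≤-reflexive (ℕ.suc-pred q {{>-nonZero (p^e>0 a)}}))
        ... | ∣I₁∣≡0 , _ | inj₁ ne₁ = ∣I∣≡0⇒¬Nonempty I₁ ∣I₁∣≡0 ne₁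
        ... | _ , sumY≈ε | inj₂ ne₂ = Y-free (I₂ , ne₂ , sumY≈ε)

module ModularCongruence (m : ℕ) where

  open import Data.Integer using (ℤ; +_; -_) renaming (_+_ to _+ℤ_; _*_ to _*ℤ_; _-_ to _-ℤ_)
  import Data.Integer.Properties as ℤ
  open import Data.Integer.Divisibility.Signed
    using (divides; ∣m∣n⇒∣m+n; ∣m⇒∣-m; ∣n⇒∣m*n) renaming (_∣_ to _∣ℤ_)
  open import Data.Integer.Tactic.RingSolver using (solve-∀)
  open import Relation.Binary.PropositionalEquality

  infix 4 _≡ₘ_
  record _≡ₘ_ (a b : ℤ) : Set where
    constructor mk≡ₘ
    field m∣difference : (+ m) ∣ℤ (a -ℤ b)
  open _≡ₘ_ public

  private
    via : ∀ {x y} → x ≡ y → (+ m) ∣ℤ x → (+ m) ∣ℤ y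
    via = subst ((+ m) ∣ℤ_)

  ≡ₘ-reflexive : ∀ {a b} → a ≡ b → a ≡ₘ b
  ≡ₘ-reflexive {a} refl = mk≡ₘ (via (sym (ℤ.+-inverseʳ a)) (divides (+ 0) refl))

  ≡ₘ-refl : ∀ {a} → a ≡ₘ a
  ≡ₘ-refl = ≡ₘ-reflexive refl

  ≡ₘ-sym : ∀ {a b} → a ≡ₘ b → b ≡ₘ a
  ≡ₘ-sym {a} {b} (mk≡ₘ m∣) = mk≡ₘ (via (flip a b) (∣m⇒∣-m m∣))
    where
    flip : ∀ a b → - (a -ℤ b) ≡ b -ℤ a
    flip = solve-∀

  ≡ₘ-trans : ∀ {a b c} → a ≡ₘ b → b ≡ₘ c → a ≡ₘ c
  ≡ₘ-trans {a} {b} {c} (mk≡ₘ m∣₁) (mk≡ₘ m∣₂) = mk≡ₘ (via (telescope a b c) (∣m∣n⇒∣m+n m∣₁ m∣₂))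
    where
    telescope : ∀ a b c → (a -ℤ b) +ℤ (b -ℤ c) ≡ a -ℤ c
    telescope = solve-∀

  ≡ₘ-+ : ∀ {a b c d} → a ≡ₘ b → c ≡ₘ d → a +ℤ c ≡ₘ b +ℤ d
  ≡ₘ-+ {a} {b} {c} {d} (mk≡ₘ m∣₁) (mk≡ₘ m∣₂) = mk≡ₘ (via (regroup a b c d) (∣m∣n⇒∣m+n m∣₁ m∣₂))
    where
    regroup : ∀ a b c d → (a -ℤ b) +ℤ (c -ℤ d) ≡ (a +ℤ c) -ℤ (b +ℤ d)
    regroup = solve-∀

  ≡ₘ-*ˡ : ∀ k {a b} → a ≡ₘ b → k *ℤ a ≡ₘ k *ℤ b
  ≡ₘ-*ˡ k {a} {b} (mk≡ₘ m∣) = mk≡ₘ (via (distrib k a b) (∣n⇒∣m*n k m∣))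
    where
    distrib : ∀ k a b → k *ℤ (a -ℤ b) ≡ k *ℤ a -ℤ k *ℤ b
    distrib = solve-∀

  ≡ₘ-neg : ∀ {a b} → a ≡ₘ b → - a ≡ₘ - b
  ≡ₘ-neg {a} {b} (mk≡ₘ m∣) = mk≡ₘ (via (distrib a b) (∣m⇒∣-m m∣))
    where
    distrib : ∀ a b → - (a -ℤ b) ≡ - a -ℤ - b
    distrib = solve-∀

  ∣⇒≡ₘ0 : ∀ {a} → (+ m) ∣ℤ a → a ≡ₘ + 0
  ∣⇒≡ₘ0 {a} m∣a = mk≡ₘ (via (sym (ℤ.+-identityʳ a)) m∣a)

  ≡ₘ0⇒∣ : ∀ {a} → a ≡ₘ + 0 → (+ m) ∣ℤ a
  ≡ₘ0⇒∣ {a} (mk≡ₘ m∣) = via (ℤ.+-identityʳ a) m∣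

module MaximalOrder {c ℓ : Level} (G : FiniteAbelianGroup c ℓ) {p : ℕ} (p-prime : Prime p) (pGroup : Defs.IsPGroup G p) where

  open import Data.Nat using (_*_; _∸_; _^_; _≤_; _<_; _≤?_)
  import Data.Nat.Properties as ℕ
  open import Data.Nat using (>-nonZero)
  open import Data.Nat.Divisibility using (_∣_; ∣⇒≤)
  open import Data.List using (List; []; _∷_)
  open import Data.List.Relation.Unary.Any using (Any; here; there)
  open import Data.Product using (Σ; ∃; _×_; _,_; proj₁; proj₂)
  open import Relation.Nullary using (¬_; yes; no; _×-dec_)
  import Relation.Binary.PropositionalEquality as ≡
  open GroupLemmas G
  open Primes p-prime using (p^e>0; ∣p^e⇒≡p^i)
  open Search using (least; least-positive-divides)

  least-annihilator-divides : ∀ x o → 1 ≤ o → o · x ≈ ε → (∀ k → k < o → ¬ (1 ≤ k × k · x ≈ ε)) →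
                              ∀ m → m · x ≈ ε → o ∣ m
  least-annihilator-divides x = least-positive-divides (λ m → m · x ≈ ε) refl
    (λ a b a·x≈ε b·x≈ε → trans (·-homo-+ x a b) (trans (∙-cong a·x≈ε b·x≈ε) (identityˡ ε)))
    (λ a b [a+b]·x≈ε b·x≈ε → trans (sym (identityʳ _))
      (trans (∙-cong refl (sym b·x≈ε)) (trans (sym (·-homo-+ x a b)) [a+b]·x≈ε)))

  order : ∀ x → Σ ℕ λ i → ((p ^ i) · x ≈ ε) × (∀ m → m · x ≈ ε → p ^ i ∣ m)
  order x with pGroup x
  ... | e , p^e·x≈ε with least (λ m → (1 ≤? m) ×-dec ((m · x) ≟ ε)) (p ^ e) (p^e>0 e , p^e·x≈ε)
  ...   | o , _ , (1≤o , o·x≈ε) , below with ∣p^e⇒≡p^i e o (least-annihilator-divides x o 1≤o o·x≈ε below (p ^ e) p^e·x≈ε)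
  ...     | i , ≡.refl = i , o·x≈ε , least-annihilator-divides x o 1≤o o·x≈ε below

  exponentOf : Carrier → ℕ
  exponentOf x = proj₁ (order x)

  maximal : ∀ (xs : List Carrier) → Σ Carrier λ g → ∀ y → Any (y ≈_) xs → ∃ λ z → (y ≈ z) × (exponentOf z ≤ exponentOf g)
  maximal [] = ε , λ y ()
  maximal (x ∷ xs) with maximal xs
  ... | g , g-max with exponentOf x ≤? exponentOf g
  ...   | yes x≤g = g , λ { y (here y≈x) → x , y≈x , x≤g ; y (there y∈) → g-max y y∈ }
  ...   | no x≰g = x , λ { y (here y≈x) → x , y≈x , ℕ.≤-refl
                         ; y (there y∈) → let z , y≈z , z≤g = g-max y y∈ in z , y≈z , ℕ.≤-trans z≤g (ℕ.<⇒≤ (ℕ.≰⇒> x≰g)) }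

  gₘₐₓ : Carrier
  gₘₐₓ = proj₁ (maximal elements)

  A : ℕ
  A = exponentOf gₘₐₓ

  gₘₐₓ-order : (p ^ A) · gₘₐₓ ≈ ε
  gₘₐₓ-order = proj₁ (proj₂ (order gₘₐₓ))

  gₘₐₓ-order-divides : ∀ m → m · gₘₐₓ ≈ ε → p ^ A ∣ m
  gₘₐₓ-order-divides = proj₂ (proj₂ (order gₘₐₓ))

  p^A-annihilates : ∀ y → (p ^ A) · y ≈ ε
  p^A-annihilates y with proj₂ (maximal elements) y (complete y)
  ... | z , y≈z , z≤A = begin
    (p ^ A) · y                                      ≈⟨ ·-congʳ (p ^ A) y≈z ⟩
    (p ^ A) · z                                      ≈⟨ ·-congˡ z split ⟩
    (p ^ (A ∸ exponentOf z) * p ^ exponentOf z) · z  ≈⟨ ·-homo-* z (p ^ (A ∸ exponentOf z)) _ ⟩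
    (p ^ (A ∸ exponentOf z)) · ((p ^ exponentOf z) · z)  ≈⟨ ·-congʳ (p ^ (A ∸ exponentOf z)) (proj₁ (proj₂ (order z))) ⟩
    (p ^ (A ∸ exponentOf z)) · ε                       ≈⟨ ·-ε (p ^ (A ∸ exponentOf z)) ⟩
    ε                                                ∎
    where
    open import Relation.Binary.Reasoning.Setoid setoid
    split : p ^ A ≡.≡ p ^ (A ∸ exponentOf z) * p ^ exponentOf z
    split = ≡.trans (≡.cong (p ^_) (≡.sym (ℕ.m∸n+n≡m z≤A))) (ℕ.^-distribˡ-+-* p (A ∸ exponentOf z) (exponentOf z))

  exponent≡p^A : ∀ {n} → Defs.IsExponent G n → n ≡.≡ p ^ A
  exponent≡p^A (n≥1 , annihilates , least-annihilator) = ℕ.≤-antisym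
    (least-annihilator (p ^ A) (p^e>0 A) p^A-annihilates)
    (∣⇒≤ {{>-nonZero n≥1}} (gₘₐₓ-order-divides _ (annihilates gₘₐₓ)))

module Characters {c ℓ : Level} (G : FiniteAbelianGroup c ℓ) (q : ℕ) (q≥1 : 1 ≤ q)
                  (q-annihilates : ∀ y → FiniteAbelianGroup._≈_ G (Defs._·_ G q y) (FiniteAbelianGroup.ε G)) where

  open import Level using (_⊔_) renaming (suc to lsuc)
  open import Data.Nat using (zero; suc; _+_; _*_; _∸_; _≤_; _<_; _≤?_; NonZero; >-nonZero; ≢-nonZero)
  import Data.Nat.Properties as ℕ
  open import Data.Nat.Divisibility using (divides) renaming (_∣_ to _∣ℕ_)
  open import Data.Nat.DivMod using (_/_; _%_; m≡m%n+[m/n]*n; m%n<n)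
  open import Data.Integer using (ℤ; +_; -_) renaming (_+_ to _+ℤ_; _*_ to _*ℤ_)
  import Data.Integer.Properties as ℤ
  open import Data.Integer.Divisibility.Signed using (*-cancelˡ-∣; ∣ᵤ⇒∣) renaming (_∣_ to _∣ℤ_)
  open import Data.Integer.Tactic.RingSolver using (solve-∀)
  open import Data.List using (List; []; _∷_)
  open import Data.List.Relation.Unary.Any using (Any; here; there)
  open import Data.Product using (Σ; ∃; _×_; _,_; proj₁; proj₂)
  open import Data.Sum using (inj₁; inj₂)
  open import Relation.Nullary using (Dec; _×-dec_)
  open import Relation.Binary.PropositionalEquality as ≡ using (_≡_)
  open GroupLemmas G
  open ModularCongruence q
  open Search using (least; least-positive-divides)

  private instance q≢0 = >-nonZero q≥1

  record PartialCharacter : Set (c ⊔ lsuc ℓ) where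
    field
      Domain : Carrier → Set ℓ
      Domain? : ∀ y → Dec (Domain y)
      Domain-resp : ∀ {y y′} → y ≈ y′ → Domain y → Domain y′
      ε∈ : Domain ε
      ∙∈ : ∀ {y z} → Domain y → Domain z → Domain (y ∙ z)
      χ : ∀ y → Domain y → ℤ
      χ-cong : ∀ {y y′} (k : Domain y) (k′ : Domain y′) → y ≈ y′ → χ y k ≡ₘ χ y′ k′
      χ-∙ : ∀ {y z} (ky : Domain y) (kz : Domain z) (kyz : Domain (y ∙ z)) → χ (y ∙ z) kyz ≡ₘ χ y ky +ℤ χ z kz

  ExtendsAt : (K′ K : PartialCharacter) → ∀ {y} → PartialCharacter.Domain K y → Set ℓ
  ExtendsAt K′ K {y} k = Σ (PartialCharacter.Domain K′ y) λ k′ → PartialCharacter.χ K′ y k′ ≡ₘ PartialCharacter.χ K y k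

  module PartialCharacterProperties (K : PartialCharacter) where

    open PartialCharacter K

    ·∈ : ∀ m {y} → Domain y → Domain (m · y)
    ·∈ zero k = ε∈
    ·∈ (suc m) k = ∙∈ k (·∈ m k)

    -∈ : ∀ {y z} → Domain y → Domain z → Domain (y - z)
    -∈ {y} {z} ky kz = ∙∈ ky (Domain-resp (inverseʳ-unique z _ q-1·z∙z≈ε) (·∈ (q ∸ 1) kz))
      where
      q-1·z∙z≈ε : z ∙ (q ∸ 1) · z ≈ ε
      q-1·z∙z≈ε = trans (·-congˡ z (ℕ.suc-pred q)) (q-annihilates z)

    χ-ε : (k : Domain ε) → χ ε k ≡ₘ + 0
    χ-ε k = ≡ₘ-trans (≡ₘ-reflexive (cancel a)) (≡ₘ-trans (≡ₘ-+ a+a≡a (≡ₘ-refl { - a})) (≡ₘ-reflexive (ℤ.+-inverseʳ a)))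
      where
      a = χ ε k
      a+a≡a : a +ℤ a ≡ₘ a
      a+a≡a = ≡ₘ-trans (≡ₘ-sym (χ-∙ k k (∙∈ k k))) (χ-cong (∙∈ k k) k (identityˡ ε))
      cancel : ∀ a → a ≡ (a +ℤ a) +ℤ - a
      cancel = solve-∀

    χ-· : ∀ m {y} (ky : Domain y) (k : Domain (m · y)) → χ (m · y) k ≡ₘ (+ m) *ℤ χ y ky
    χ-· zero {y} ky k = ≡ₘ-trans (χ-ε k) (≡ₘ-reflexive (≡.sym (ℤ.*-zeroˡ (χ y ky))))
    χ-· (suc m) {y} ky k = ≡ₘ-trans (χ-∙ ky (·∈ m ky) k)
      (≡ₘ-trans (≡ₘ-+ (≡ₘ-refl {χ y ky}) (χ-· m ky (·∈ m ky))) (≡ₘ-reflexive (distrib (χ y ky) (+ m))))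
      where
      distrib : ∀ a m → a +ℤ m *ℤ a ≡ (+ 1 +ℤ m) *ℤ a
      distrib = solve-∀

  -- The extension of K to ⟨K, x⟩: with m₀ the least positive m such that m · x ∈ K, any v with
  -- m₀ v ≡ χ (m₀ · x) gives a well defined character y ∙ c · x ↦ χ y + c v.
  module Extension (K : PartialCharacter) (x : Carrier) where

    open PartialCharacter K
    open PartialCharacterProperties K

    private
      least-m₀ : ∃ λ m → m ≤ q × Search.Least {P = λ m → 1 ≤ m × Domain (m · x)} m
      least-m₀ = least (λ m → (1 ≤? m) ×-dec Domain? (m · x)) q (q≥1 , Domain-resp (sym (q-annihilates x)) ε∈)

    m₀ : ℕ
    m₀ = proj₁ least-m₀

    1≤m₀ : 1 ≤ m₀
    1≤m₀ = proj₁ (proj₁ (proj₂ (proj₂ least-m₀)))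

    m₀·x∈ : Domain (m₀ · x)
    m₀·x∈ = proj₂ (proj₁ (proj₂ (proj₂ least-m₀)))

    m₀∣ : ∀ d → Domain (d · x) → m₀ ∣ℕ d
    m₀∣ = least-positive-divides (λ m → Domain (m · x)) ε∈
      (λ a b a∈ b∈ → Domain-resp (sym (·-homo-+ x a b)) (∙∈ a∈ b∈))
      (λ a b a+b∈ b∈ → Domain-resp (≈∙⇒-≈ (·-homo-+ x a b)) (-∈ a+b∈ b∈))
      m₀ 1≤m₀ m₀·x∈ (proj₂ (proj₂ (proj₂ least-m₀)))

    -- Writing q = r m₀, the relation r · (m₀ · x) = q · x = ε forces q ∣ r χ (m₀ · x), i.e. m₀ ∣ χ (m₀ · x).
    value : Σ ℤ λ v → (+ m₀) *ℤ v ≡ₘ χ (m₀ · x) m₀·x∈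
    value with m₀∣ q (Domain-resp (sym (q-annihilates x)) ε∈)
    ... | divides r q≡r*m₀ = v , ≡ₘ-reflexive (≡.trans (ℤ.*-comm (+ m₀) v) (≡.sym (_∣ℤ_.equality m₀∣χ)))
      where
      r≢0 : NonZero r
      r≢0 = ≢-nonZero λ { ≡.refl → ℕ.<⇒≢ q≥1 (≡.sym q≡r*m₀) }
      r·m₀·x≈ε : r · (m₀ · x) ≈ ε
      r·m₀·x≈ε = trans (sym (·-homo-* x r m₀)) (trans (·-congˡ x (≡.sym q≡r*m₀)) (q-annihilates x))
      q∣rχ : (+ q) ∣ℤ ((+ r) *ℤ χ (m₀ · x) m₀·x∈)
      q∣rχ = ≡ₘ0⇒∣ (≡ₘ-trans (≡ₘ-sym (χ-· r m₀·x∈ (·∈ r m₀·x∈)))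
        (≡ₘ-trans (χ-cong (·∈ r m₀·x∈) ε∈ r·m₀·x≈ε) (χ-ε ε∈)))
      m₀∣χ : (+ m₀) ∣ℤ χ (m₀ · x) m₀·x∈
      m₀∣χ = *-cancelˡ-∣ (+ r) {{r≢0}} (≡.subst (_∣ℤ ((+ r) *ℤ χ (m₀ · x) m₀·x∈)) (≡.trans (≡.cong +_ q≡r*m₀) (ℤ.pos-* r m₀)) q∣rχ)
      v : ℤ
      v = _∣ℤ_.quotient m₀∣χ

    module WithValue (v : ℤ) (m₀v≡χ : (+ m₀) *ℤ v ≡ₘ χ (m₀ · x) m₀·x∈) where

      Domain′ : Carrier → Set ℓ
      Domain′ y = ∃ λ c → c < q × Domain (y - c · x)

      χ′ : ∀ y → Domain′ y → ℤ
      χ′ y (c , _ , k) = χ (y - c · x) k +ℤ (+ c) *ℤ v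

      a≈a′∙[c₂∸c₁]·x : ∀ {a a′} c₁ c₂ → c₁ ≤ c₂ → a ∙ c₁ · x ≈ a′ ∙ c₂ · x → a ≈ a′ ∙ (c₂ ∸ c₁) · x
      a≈a′∙[c₂∸c₁]·x {a} {a′} c₁ c₂ c₁≤c₂ eq = trans (sym ([x∙y]-y≈x a (c₁ · x))) (≈∙⇒-≈ (begin
        a ∙ c₁ · x                     ≈⟨ eq ⟩
        a′ ∙ c₂ · x                    ≈⟨ ∙-cong refl (·-congˡ x (≡.sym (ℕ.m∸n+n≡m c₁≤c₂))) ⟩
        a′ ∙ (c₂ ∸ c₁ + c₁) · x        ≈⟨ ∙-cong refl (·-homo-+ x (c₂ ∸ c₁) c₁) ⟩
        a′ ∙ ((c₂ ∸ c₁) · x ∙ c₁ · x)  ≈⟨ sym (assoc _ _ _) ⟩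
        a′ ∙ (c₂ ∸ c₁) · x ∙ c₁ · x    ∎))
        where open import Relation.Binary.Reasoning.Setoid setoid

      χ′-well-defined≤ : ∀ {a a′} (ka : Domain a) (ka′ : Domain a′) c₁ c₂ → c₁ ≤ c₂ → a ∙ c₁ · x ≈ a′ ∙ c₂ · x →
                         χ a ka +ℤ (+ c₁) *ℤ v ≡ₘ χ a′ ka′ +ℤ (+ c₂) *ℤ v
      χ′-well-defined≤ {a} {a′} ka ka′ c₁ c₂ c₁≤c₂ eq =
        from-divides (m₀∣ (c₂ ∸ c₁) (Domain-resp (≈∙⇒-≈ (trans a≈ (comm _ _))) (-∈ ka ka′)))
        where
        a≈ : a ≈ a′ ∙ (c₂ ∸ c₁) · x
        a≈ = a≈a′∙[c₂∸c₁]·x c₁ c₂ c₁≤c₂ eq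
        from-divides : m₀ ∣ℕ (c₂ ∸ c₁) → χ a ka +ℤ (+ c₁) *ℤ v ≡ₘ χ a′ ka′ +ℤ (+ c₂) *ℤ v
        from-divides (divides f d≡f*m₀) = ≡ₘ-trans (≡ₘ-+ χa≡ (≡ₘ-refl {(+ c₁) *ℤ v})) (≡ₘ-reflexive collect)
          where
          d·x≈f·[m₀·x] : (c₂ ∸ c₁) · x ≈ f · (m₀ · x)
          d·x≈f·[m₀·x] = trans (·-congˡ x d≡f*m₀) (·-homo-* x f m₀)
          d·x∈ : Domain ((c₂ ∸ c₁) · x)
          d·x∈ = Domain-resp (sym d·x≈f·[m₀·x]) (·∈ f m₀·x∈)
          χa≡ : χ a ka ≡ₘ χ a′ ka′ +ℤ (+ f) *ℤ ((+ m₀) *ℤ v)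
          χa≡ = ≡ₘ-trans (χ-cong ka (∙∈ ka′ d·x∈) a≈)
            (≡ₘ-trans (χ-∙ ka′ d·x∈ (∙∈ ka′ d·x∈))
              (≡ₘ-+ (≡ₘ-refl {χ a′ ka′})
                (≡ₘ-trans (χ-cong d·x∈ (·∈ f m₀·x∈) d·x≈f·[m₀·x])
                  (≡ₘ-trans (χ-· f m₀·x∈ (·∈ f m₀·x∈)) (≡ₘ-*ˡ (+ f) (≡ₘ-sym m₀v≡χ))))))
          collect : χ a′ ka′ +ℤ (+ f) *ℤ ((+ m₀) *ℤ v) +ℤ (+ c₁) *ℤ v ≡ χ a′ ka′ +ℤ (+ c₂) *ℤ v
          collect = ≡.trans (factor (χ a′ ka′) (+ f) (+ m₀) v (+ c₁)) (≡.cong (λ w → χ a′ ka′ +ℤ w *ℤ v)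
            (≡.trans (≡.cong (_+ℤ + c₁) (≡.sym (ℤ.pos-* f m₀)))
              (≡.cong +_ (≡.trans (≡.cong (_+ c₁) (≡.sym d≡f*m₀)) (ℕ.m∸n+n≡m c₁≤c₂)))))
            where
            factor : ∀ A F M V C → A +ℤ F *ℤ (M *ℤ V) +ℤ C *ℤ V ≡ A +ℤ (F *ℤ M +ℤ C) *ℤ V
            factor = solve-∀

      χ′-well-defined : ∀ {a a′} (ka : Domain a) (ka′ : Domain a′) c₁ c₂ → a ∙ c₁ · x ≈ a′ ∙ c₂ · x →
                        χ a ka +ℤ (+ c₁) *ℤ v ≡ₘ χ a′ ka′ +ℤ (+ c₂) *ℤ v
      χ′-well-defined ka ka′ c₁ c₂ eq with ℕ.≤-total c₁ c₂
      ... | inj₁ c₁≤c₂ = χ′-well-defined≤ ka ka′ c₁ c₂ c₁≤c₂ eq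
      ... | inj₂ c₂≤c₁ = ≡ₘ-sym (χ′-well-defined≤ ka′ ka c₂ c₁ c₂≤c₁ (sym eq))

      Domain′-intro : ∀ {y} c → Domain (y - c · x) → Domain′ y
      Domain′-intro {y} c k = c % q , m%n<n c q , Domain-resp (//-cong₂ refl reduce) k
        where
        reduce : c · x ≈ (c % q) · x
        reduce = trans (·-congˡ x (m≡m%n+[m/n]*n c q)) (trans (·-homo-+ x (c % q) _)
          (trans (∙-cong refl (trans (·-homo-* x (c / q) q) (trans (·-congʳ (c / q) (q-annihilates x)) (·-ε (c / q)))))
            (identityʳ _)))

      extension : PartialCharacter
      extension = record
        { Domain = Domain′
        ; Domain? = λ y → ℕ.anyUpTo? (λ c → Domain? (y - c · x)) q
        ; Domain-resp = λ { eq (c , c<q , k) → c , c<q , Domain-resp (//-cong₂ eq refl) k }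
        ; ε∈ = 0 , q≥1 , Domain-resp (sym (inverseʳ ε)) ε∈
        ; ∙∈ = λ { {y} {z} (c₁ , _ , k₁) (c₂ , _ , k₂) →
            Domain′-intro (c₁ + c₂) (Domain-resp (distrib y z c₁ c₂) (∙∈ k₁ k₂)) }
        ; χ = χ′
        ; χ-cong = λ { {y} {y′} (c₁ , _ , k₁) (c₂ , _ , k₂) eq →
            χ′-well-defined k₁ k₂ c₁ c₂ (trans ([x-y]∙y≈x y (c₁ · x)) (trans eq (sym ([x-y]∙y≈x y′ (c₂ · x))))) }
        ; χ-∙ = λ { {y} {z} (c₁ , _ , k₁) (c₂ , _ , k₂) (c₃ , _ , k₃) →
            ≡ₘ-trans (χ′-well-defined k₃ (∙∈ k₁ k₂) c₃ (c₁ + c₂)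
                       (trans ([x-y]∙y≈x (y ∙ z) (c₃ · x)) (sym (trans (∙-cong (distrib y z c₁ c₂) refl) ([x-y]∙y≈x (y ∙ z) ((c₁ + c₂) · x))))))
              (≡ₘ-trans (≡ₘ-+ (χ-∙ k₁ k₂ (∙∈ k₁ k₂)) (≡ₘ-refl {(+ (c₁ + c₂)) *ℤ v}))
                (≡ₘ-reflexive (regroup (χ (y - c₁ · x) k₁) (χ (z - c₂ · x) k₂) c₁ c₂))) }
        }
        where
        distrib : ∀ y z c₁ c₂ → (y - c₁ · x) ∙ (z - c₂ · x) ≈ (y ∙ z) - (c₁ + c₂) · x
        distrib y z c₁ c₂ = trans (-‿distrib-∙ y z (c₁ · x) (c₂ · x)) (//-cong₂ refl (sym (·-homo-+ x c₁ c₂)))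
        regroup′ : ∀ A B C D V → A +ℤ B +ℤ (C +ℤ D) *ℤ V ≡ A +ℤ C *ℤ V +ℤ (B +ℤ D *ℤ V)
        regroup′ = solve-∀
        regroup : ∀ A B c₁ c₂ → A +ℤ B +ℤ (+ (c₁ + c₂)) *ℤ v ≡ A +ℤ (+ c₁) *ℤ v +ℤ (B +ℤ (+ c₂) *ℤ v)
        regroup A B c₁ c₂ = ≡.trans (≡.cong (λ w → A +ℤ B +ℤ w *ℤ v) (ℤ.pos-+ c₁ c₂)) (regroup′ A B (+ c₁) (+ c₂) v)

      extends : ∀ {y} (k : Domain y) → ExtendsAt extension K k
      extends {y} k = k′ , ≡ₘ-trans (≡ₘ-+ (χ-cong (proj₂ (proj₂ k′)) k (x-ε≈x y)) (≡ₘ-refl {+ 0 *ℤ v}))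
                                  (≡ₘ-reflexive (ℤ.+-identityʳ (χ y k)))
        where
        k′ : Domain′ y
        k′ = 0 , q≥1 , Domain-resp (sym (x-ε≈x y)) k

      x∈ : Domain′ x
      x∈ = Domain′-intro 1 (Domain-resp (sym (trans (//-cong₂ refl (·-homo-1 x)) (inverseʳ x))) ε∈)

      χ′[x]≡v : (k : Domain′ x) → χ′ x k ≡ₘ v
      χ′[x]≡v (c , _ , k) = ≡ₘ-trans (χ′-well-defined k ε∈ c 1 (trans ([x-y]∙y≈x x (c · x)) (sym (trans (identityˡ _) (·-homo-1 x)))))
        (≡ₘ-trans (≡ₘ-+ (χ-ε ε∈) (≡ₘ-refl {+ 1 *ℤ v})) (≡ₘ-reflexive (≡.trans (ℤ.+-identityˡ _) (ℤ.*-identityˡ v))))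

  trivial : PartialCharacter
  trivial = record
    { Domain = λ y → y ≈ ε
    ; Domain? = λ y → y ≟ ε
    ; Domain-resp = λ eq k → trans (sym eq) k
    ; ε∈ = refl
    ; ∙∈ = λ k₁ k₂ → trans (∙-cong k₁ k₂) (identityˡ ε)
    ; χ = λ _ _ → + 0
    ; χ-cong = λ _ _ _ → ≡ₘ-refl
    ; χ-∙ = λ _ _ _ → ≡ₘ-refl
    }

  extend : PartialCharacter → Carrier → PartialCharacter
  extend K x = Extension.WithValue.extension K x (proj₁ (Extension.value K x)) (proj₂ (Extension.value K x))

  extend-extends : ∀ K x {y} (k : PartialCharacter.Domain K y) → ExtendsAt (extend K x) K k
  extend-extends K x = Extension.WithValue.extends K x (proj₁ (Extension.value K x)) (proj₂ (Extension.value K x))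

  extendAll : List Carrier → PartialCharacter → PartialCharacter
  extendAll [] K = K
  extendAll (x ∷ xs) K = extendAll xs (extend K x)

  extendAll-extends : ∀ xs K {y} (k : PartialCharacter.Domain K y) → ExtendsAt (extendAll xs K) K k
  extendAll-extends [] K k = k , ≡ₘ-refl
  extendAll-extends (x ∷ xs) K k =
    proj₁ later , ≡ₘ-trans (proj₂ later) (proj₂ now)
    where
    now : ExtendsAt (extend K x) K k
    now = extend-extends K x k
    later : ExtendsAt (extendAll xs (extend K x)) (extend K x) (proj₁ now)
    later = extendAll-extends xs (extend K x) (proj₁ now)

  extendAll-total : ∀ xs K y → Any (y ≈_) xs → PartialCharacter.Domain (extendAll xs K) y
  extendAll-total (x ∷ xs) K y (here y≈x) = proj₁ (extendAll-extends xs (extend K x)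
    (PartialCharacter.Domain-resp (extend K x) (sym y≈x)
      (Extension.WithValue.x∈ K x (proj₁ (Extension.value K x)) (proj₂ (Extension.value K x)))))
  extendAll-total (x ∷ xs) K y (there y∈) = extendAll-total xs (extend K x) y y∈

  record Character (g : Carrier) : Set (c ⊔ ℓ) where
    field
      φ : Carrier → ℤ
      φ-cong : ∀ {y y′} → y ≈ y′ → φ y ≡ₘ φ y′
      φ-∙ : ∀ y z → φ (y ∙ z) ≡ₘ φ y +ℤ φ z
      φ-ε : φ ε ≡ₘ + 0
      φ-· : ∀ m y → φ (m · y) ≡ₘ (+ m) *ℤ φ y
      φ-g : φ g ≡ₘ + 1

  -- On ⟨g⟩ the value 1 at g is consistent exactly because g has order q.
  character : ∀ g → (∀ m → m · g ≈ ε → q ∣ℕ m) → Character g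
  character g order∣ = record
    { φ = φ
    ; φ-cong = λ {y} {y′} eq → χ-cong (total y) (total y′) eq
    ; φ-∙ = λ y z → χ-∙ (total y) (total z) (total (y ∙ z))
    ; φ-ε = χ-ε (total ε)
    ; φ-· = λ m y → χ-· m (total y) (total (m · y))
    ; φ-g = ≡ₘ-trans (χ-cong (total g) (proj₁ g-extends) refl)
              (≡ₘ-trans (proj₂ g-extends) (Extension.WithValue.χ′[x]≡v trivial g (+ 1) m₀≡0 g∈))
    }
    where
    m₀≡0 : (+ Extension.m₀ trivial g) *ℤ (+ 1) ≡ₘ + 0
    m₀≡0 = ∣⇒≡ₘ0 (≡.subst ((+ q) ∣ℤ_) (≡.sym (ℤ.*-identityʳ (+ Extension.m₀ trivial g)))
      (∣ᵤ⇒∣ (order∣ (Extension.m₀ trivial g) (Extension.m₀·x∈ trivial g))))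
    on⟨g⟩ : PartialCharacter
    on⟨g⟩ = Extension.WithValue.extension trivial g (+ 1) m₀≡0
    g∈ : PartialCharacter.Domain on⟨g⟩ g
    g∈ = Extension.WithValue.x∈ trivial g (+ 1) m₀≡0
    open PartialCharacter (extendAll elements on⟨g⟩)
    open PartialCharacterProperties (extendAll elements on⟨g⟩)
    total : ∀ y → Domain y
    total y = extendAll-total elements on⟨g⟩ y (complete y)
    φ : Carrier → ℤ
    φ y = χ y (total y)
    g-extends : ExtendsAt (extendAll elements on⟨g⟩) on⟨g⟩ g∈
    g-extends = extendAll-extends elements on⟨g⟩ g∈

module Kernel {c ℓ : Level} (G : FiniteAbelianGroup c ℓ) (q : ℕ) (q≥2 : 2 ≤ q)
              (q-annihilates : ∀ y → FiniteAbelianGroup._≈_ G (Defs._·_ G q y) (FiniteAbelianGroup.ε G))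
              (g : FiniteAbelianGroup.Carrier G)
              (character : Characters.Character G q (Data.Nat.Properties.<⇒≤ q≥2) q-annihilates g) where

  open import Data.Nat using (zero; suc; _^_; _<_; z≤n; s≤s; >-nonZero)
  import Data.Nat.Properties as ℕ
  open import Data.Nat.Divisibility using (∣⇒≤) renaming (_∣_ to _∣ℕ_)
  open import Data.Integer using (ℤ; +_; -_) renaming (_+_ to _+ℤ_; _*_ to _*ℤ_; _-_ to _-ℤ_)
  import Data.Integer.Properties as ℤ
  open import Data.Integer.DivMod using (_%ℕ_; _/ℕ_; a≡a%ℕn+[a/ℕn]*n)
  open import Data.Integer.Divisibility.Signed using (divides; _∣?_; ∣⇒∣ᵤ) renaming (_∣_ to _∣ℤ_)
  open import Data.Integer.Tactic.RingSolver using (solve-∀)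
  open import Data.List using (List; []; _∷_; length)
  open import Data.List.Relation.Unary.Any using (Any; here; there)
  open import Data.Product using (Σ; ∃; _×_; _,_; proj₁; proj₂)
  open import Data.Empty using (⊥-elim)
  open import Relation.Nullary using (¬_; yes; no)
  open import Relation.Binary.PropositionalEquality as ≡ using (_≡_)
  open import Algebra.Bundles using (AbelianGroup)
  open GroupLemmas G
  open ModularCongruence q
  open Characters.Character character

  φ-homo-− : ∀ y z → φ (y - z) ≡ₘ φ y -ℤ φ z
  φ-homo-− y z = ≡ₘ-trans (≡ₘ-reflexive (cancel (φ (y - z)) (φ z))) (≡ₘ-+ φ[y-z]+φz≡φy (≡ₘ-refl { - φ z}))
    where
    φ[y-z]+φz≡φy : φ (y - z) +ℤ φ z ≡ₘ φ y
    φ[y-z]+φz≡φy = ≡ₘ-trans (≡ₘ-sym (φ-∙ (y - z) z)) (φ-cong ([x-y]∙y≈x y z))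
    cancel : ∀ a b → a ≡ a +ℤ b -ℤ b
    cancel = solve-∀

  InKernel : Carrier → Set
  InKernel y = (+ q) ∣ℤ φ y

  InKernel-resp : ∀ {y y′} → y ≈ y′ → InKernel y → InKernel y′
  InKernel-resp eq k = ≡ₘ0⇒∣ (≡ₘ-trans (≡ₘ-sym (φ-cong eq)) (∣⇒≡ₘ0 k))

  kernelGroup : AbelianGroup c ℓ
  kernelGroup = record
    { Carrier = Σ Carrier InKernel
    ; _≈_ = λ a b → proj₁ a ≈ proj₁ b
    ; _∙_ = λ { (y , ky) (z , kz) → y ∙ z , ≡ₘ0⇒∣ (≡ₘ-trans (φ-∙ y z) (≡ₘ-+ (∣⇒≡ₘ0 ky) (∣⇒≡ₘ0 kz))) }
    ; ε = ε , ≡ₘ0⇒∣ φ-ε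
    ; _⁻¹ = λ { (y , ky) → y ⁻¹ , InKernel-resp (identityˡ _)
        (≡ₘ0⇒∣ (≡ₘ-trans (φ-homo-− ε y) (≡ₘ-+ φ-ε (≡ₘ-neg (∣⇒≡ₘ0 ky))))) }
    ; isAbelianGroup = record
      { isGroup = record
        { isMonoid = record
          { isSemigroup = record
            { isMagma = record
              { isEquivalence = record { refl = refl ; sym = sym ; trans = trans }
              ; ∙-cong = ∙-cong }
            ; assoc = λ a b c → assoc (proj₁ a) (proj₁ b) (proj₁ c) }
          ; identity = (λ a → identityˡ (proj₁ a)) , (λ a → identityʳ (proj₁ a)) }
        ; inverse = (λ a → inverseˡ (proj₁ a)) , (λ a → inverseʳ (proj₁ a))
        ; ⁻¹-cong = ⁻¹-cong }
      ; comm = λ a b → comm (proj₁ a) (proj₁ b) }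
    }

  inKernel : List Carrier → List (Σ Carrier InKernel)
  inKernel [] = []
  inKernel (y ∷ ys) with (+ q) ∣? φ y
  ... | yes ky = (y , ky) ∷ inKernel ys
  ... | no _ = inKernel ys

  inKernel-complete : ∀ (a : Σ Carrier InKernel) ys → Any (proj₁ a ≈_) ys → Any (λ b → proj₁ a ≈ proj₁ b) (inKernel ys)
  inKernel-complete a (y ∷ ys) a∈ with (+ q) ∣? φ y | a∈
  ... | yes ky | here a≈y = here a≈y
  ... | yes ky | there a∈ys = there (inKernel-complete a ys a∈ys)
  ... | no ¬ky | here a≈y = ⊥-elim (¬ky (InKernel-resp a≈y (proj₂ a)))
  ... | no ¬ky | there a∈ys = inKernel-complete a ys a∈ys

  inKernel-≤ : ∀ ys → length (inKernel ys) ≤ length ys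
  inKernel-≤ [] = z≤n
  inKernel-≤ (y ∷ ys) with (+ q) ∣? φ y
  ... | yes _ = s≤s (inKernel-≤ ys)
  ... | no _ = ℕ.m≤n⇒m≤1+n (inKernel-≤ ys)

  inKernel-< : ∀ ys → Any (λ z → ¬ InKernel z) ys → length (inKernel ys) < length ys
  inKernel-< (y ∷ ys) y∉∨ with (+ q) ∣? φ y | y∉∨
  ... | yes ky | here y∉ = ⊥-elim (y∉ ky)
  ... | no _ | _ = s≤s (inKernel-≤ ys)
  ... | yes _ | there ys∉ = s≤s (inKernel-< ys ys∉)

  Kernel : FiniteAbelianGroup c ℓ
  Kernel = record
    { abelianGroup = kernelGroup
    ; _≟_ = λ a b → proj₁ a ≟ proj₁ b
    ; elements = inKernel elements
    ; complete = λ a → inKernel-complete a elements (complete (proj₁ a))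
    }

  Kernel-smaller : length (FiniteAbelianGroup.elements Kernel) < length elements
  Kernel-smaller = inKernel-< elements (g∉ (complete g))
    where
    g∉ : ∀ {ys} → Any (g ≈_) ys → Any (λ z → ¬ InKernel z) ys
    g∉ (here g≈z) = here λ kz → ℕ.<⇒≱ q≥2 (∣⇒≤ (∣⇒∣ᵤ (≡ₘ0⇒∣ (≡ₘ-trans (≡ₘ-sym φ-g) (≡ₘ-trans (φ-cong g≈z) (∣⇒≡ₘ0 kz))))))
    g∉ (there g∈) = there (g∉ g∈)

  Kernel-pGroup : ∀ {p} → Defs.IsPGroup G p → Defs.IsPGroup Kernel p
  Kernel-pGroup {p} pGroup a = proj₁ (pGroup (proj₁ a)) , trans (·-inKernel (p ^ proj₁ (pGroup (proj₁ a))) a) (proj₂ (pGroup (proj₁ a)))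
    where
    ·-inKernel : ∀ m (b : Σ Carrier InKernel) → proj₁ (Defs._·_ Kernel m b) ≈ m · proj₁ b
    ·-inKernel zero b = refl
    ·-inKernel (suc m) b = ∙-cong refl (·-inKernel m b)

  module _ {p : ℕ} (p-prime : Prime p) (a : ℕ) (q≡p^a : q ≡ p ^ a) (g-order : q · g ≈ ε) where

    private instance q≢0 = >-nonZero (ℕ.<⇒≤ q≥2)

    φ-·g : ∀ k → φ (k · g) ≡ₘ + k
    φ-·g k = ≡ₘ-trans (φ-· k g) (≡ₘ-trans (≡ₘ-*ˡ (+ k) φ-g) (≡ₘ-reflexive (ℤ.*-identityʳ (+ k))))

    -- x = k · g ∙ (x - k · g) with k = φ x mod q, and then φ (x - k · g) ≡ 0.
    splitting : Olson.CyclicSplitting p-prime G Kernel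
    splitting = record
      { g = g
      ; a = a
      ; g-order = trans (·-congˡ g (≡.sym q≡p^a)) g-order
      ; ι = proj₁
      ; ι-cong = λ eq → eq
      ; ι-∙ = λ _ _ → refl
      ; decompose = decompose
      ; independent = independent
      }
      where
      decompose : ∀ x → ∃ λ k → ∃ λ (y : Σ Carrier InKernel) → x ≈ (k · g) ∙ proj₁ y
      decompose x = k , (x - k · g , k-removed) , sym (x∙[y-x]≈y (k · g) x)
        where
        k : ℕ
        k = φ x %ℕ q
        φx-k : φ x -ℤ + k ≡ (φ x /ℕ q) *ℤ + q
        φx-k = ≡.trans (≡.cong (_-ℤ + k) (a≡a%ℕn+[a/ℕn]*n (φ x) q)) (cancel (+ k) (φ x /ℕ q *ℤ + q))
          where
          cancel : ∀ a b → a +ℤ b -ℤ a ≡ b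
          cancel = solve-∀
        k-removed : InKernel (x - k · g)
        k-removed = ≡ₘ0⇒∣ (≡ₘ-trans (φ-homo-− x (k · g)) (≡ₘ-trans (≡ₘ-+ (≡ₘ-refl {φ x}) (≡ₘ-neg (φ-·g k)))
          (∣⇒≡ₘ0 (divides (φ x /ℕ q) φx-k))))
      independent : ∀ k (y : Σ Carrier InKernel) → k < p ^ a → (k · g) ∙ proj₁ y ≈ ε → (k ≡ 0) × (proj₁ y ≈ ε)
      independent k (y , ky) k<p^a k·g∙y≈ε = k≡0 , trans (sym (identityˡ y)) (trans (∙-cong (·-congˡ g (≡.sym k≡0)) refl) k·g∙y≈ε)
        where
        k≡0[q] : + k ≡ₘ + 0
        k≡0[q] = ≡ₘ-trans (≡ₘ-reflexive (≡.sym (ℤ.+-identityʳ (+ k))))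
          (≡ₘ-trans (≡ₘ-+ (≡ₘ-sym (φ-·g k)) (≡ₘ-sym (∣⇒≡ₘ0 ky)))
            (≡ₘ-trans (≡ₘ-sym (φ-∙ (k · g) y)) (≡ₘ-trans (φ-cong k·g∙y≈ε) φ-ε)))
        below : ∀ k → q ∣ℕ k → k < p ^ a → k ≡ 0
        below zero _ _ = ≡.refl
        below (suc k) q∣ k<p^a = ⊥-elim (ℕ.<⇒≱ (≡.subst (suc k <_) (≡.sym q≡p^a) k<p^a) (∣⇒≤ q∣))
        k≡0 : k ≡ 0
        k≡0 = below k (∣⇒∣ᵤ (≡ₘ0⇒∣ k≡0[q])) k<p^a

module PGroupStructure {p : ℕ} (p-prime : Prime p) where

  open import Data.Nat using (zero; suc; _∸_; _+_; _^_; >-nonZero)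
  import Data.Nat.Properties as ℕ
  open import Data.Integer using (+_) renaming (_-_ to _-ℤ_)
  import Data.Integer.Properties as ℤ
  open import Data.Integer.Divisibility.Signed using (divides) renaming (_∣_ to _∣ℤ_)
  open import Data.List using ([]; _∷_; length)
  open import Data.Vec using ([])
  open import Data.Product using (∃; _×_; _,_)
  open import Relation.Binary.PropositionalEquality as ≡ using (subst)
  open Olson
  open Primes p-prime using (p≥2; p^e>0)

  module _ {c ℓ : Level} (G : FiniteAbelianGroup c ℓ) where

    open GroupLemmas G
    open FiniteDifferences G

    trivial-vanishes : (∀ y → y ≈ ε) → DifferencesVanishAbove G p 0
    trivial-vanishes trivial (y ∷ ys) _ F resp = ∣ᶠ-at λ x → subst ((+ p) ∣ℤ_)
      (≡.sym (≡.trans (≡.cong (Δ* ys F x -ℤ_) (Δ*-respectful ys resp (trans (trivial _) (sym (trivial x)))))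
        (ℤ.+-inverseʳ (Δ* ys F x))))
      (divides (+ 0) ≡.refl)

    empty-zeroSumFree : ZeroSumFreeOfLength G 0
    empty-zeroSumFree = [] , λ { ([] , (() , _) , _) }

  -- Split off a cyclic factor of maximal order and recurse on the (smaller) kernel of its character.
  olson : ∀ {c ℓ} (size : ℕ) (G : FiniteAbelianGroup c ℓ) → length (FiniteAbelianGroup.elements G) ≤ size →
          Defs.IsPGroup G p → ∃ λ w → DifferencesVanishAbove G p w × ZeroSumFreeOfLength G w
  olson zero G size≤ pGroup with FiniteAbelianGroup.elements G | FiniteAbelianGroup.complete G (FiniteAbelianGroup.ε G)
  ... | [] | ()
  olson (suc size) G size≤ pGroup = from-maximal A gₘₐₓ gₘₐₓ-order gₘₐₓ-order-divides p^A-annihilates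
    where
    open GroupLemmas G using (Carrier; _≈_; ε; _·_; trans; sym; ·-homo-1)
    open MaximalOrder G p-prime pGroup using (A; gₘₐₓ; gₘₐₓ-order; gₘₐₓ-order-divides; p^A-annihilates)
    open import Data.Nat.Divisibility using (_∣_)
    from-maximal : ∀ A (g : Carrier) → (p ^ A) · g ≈ ε → (∀ m → m · g ≈ ε → p ^ A ∣ m) → (∀ y → (p ^ A) · y ≈ ε) →
                   ∃ λ w → DifferencesVanishAbove G p w × ZeroSumFreeOfLength G w
    from-maximal zero g _ _ annihilates =
      0 , trivial-vanishes G (λ y → trans (sym (·-homo-1 y)) (annihilates y)) , empty-zeroSumFree G
    from-maximal (suc A′) g g-order order∣ annihilates = combine (olson size Kernel size≤′ (Kernel-pGroup pGroup))
      where
      q : ℕ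
      q = p ^ suc A′
      q≥2 : 2 ≤ q
      q≥2 = ℕ.≤-trans p≥2 (ℕ.m≤m*n p (p ^ A′) {{>-nonZero (p^e>0 A′)}})
      open Kernel G q q≥2 annihilates g (Characters.character G q (ℕ.<⇒≤ q≥2) annihilates g order∣)
      size≤′ : length (FiniteAbelianGroup.elements Kernel) ≤ size
      size≤′ = ℕ.≤-pred (ℕ.≤-trans Kernel-smaller size≤)
      split : Olson.CyclicSplitting p-prime G Kernel
      split = splitting p-prime (suc A′) ≡.refl g-order
      combine : (∃ λ w → DifferencesVanishAbove Kernel p w × ZeroSumFreeOfLength Kernel w) →
                ∃ λ w → DifferencesVanishAbove G p w × ZeroSumFreeOfLength G w
      combine (w , vanish , free) = q ∸ 1 + w , differencesVanish p-prime G Kernel split w vanish , zeroSumFree p-prime G Kernel split w free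

-- G × ℤ/n, with ℤ/n modelled as ℤ up to congruence mod n.
module ProductWithCyclic {c ℓ : Level} (G : FiniteAbelianGroup c ℓ) (n : ℕ) (n≥1 : 1 ≤ n) where

  open import Data.Nat using (zero; suc; _^_; _<_; >-nonZero)
  import Data.Nat.Properties as ℕ
  open import Data.Nat.Divisibility using (∣⇒≤) renaming (_∣_ to _∣ℕ_)
  open import Data.Integer using (ℤ; +_; -_) renaming (_+_ to _+ℤ_; _-_ to _-ℤ_)
  import Data.Integer.Properties as ℤ
  open import Data.Integer.DivMod using (_%ℕ_; _/ℕ_; a≡a%ℕn+[a/ℕn]*n; n%ℕd<d)
  open import Data.Integer.Divisibility.Signed using (divides; _∣?_; ∣⇒∣ᵤ)
  open import Data.Integer.Tactic.RingSolver using (solve-∀)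
  open import Data.List using (applyUpTo; cartesianProduct)
  open import Data.List.Relation.Unary.Any.Properties using (cartesianProduct⁺; applyUpTo⁺)
  open import Data.Product using (_×_; _,_; proj₁; proj₂)
  open import Data.Empty using (⊥-elim)
  open import Relation.Nullary using (_×-dec_)
  import Relation.Nullary.Decidable as Dec
  open import Relation.Binary.PropositionalEquality as ≡ using (_≡_)
  open import Algebra.Bundles using (AbelianGroup)
  open GroupLemmas G
  open ModularCongruence n

  private instance n≢0 = >-nonZero n≥1

  r≡r%n : ∀ r → r ≡ₘ + (r %ℕ n)
  r≡r%n r = mk≡ₘ (divides (r /ℕ n) (≡.trans (≡.cong (_-ℤ + (r %ℕ n)) (a≡a%ℕn+[a/ℕn]*n r n)) (cancel (+ (r %ℕ n)) _)))
    where
    cancel : ∀ a b → a +ℤ b -ℤ a ≡ b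
    cancel = solve-∀

  productGroup : AbelianGroup c ℓ
  productGroup = record
    { Carrier = Carrier × ℤ
    ; _≈_ = λ a b → (proj₁ a ≈ proj₁ b) × (proj₂ a ≡ₘ proj₂ b)
    ; _∙_ = λ a b → proj₁ a ∙ proj₁ b , proj₂ a +ℤ proj₂ b
    ; ε = ε , + 0
    ; _⁻¹ = λ a → proj₁ a ⁻¹ , - proj₂ a
    ; isAbelianGroup = record
      { isGroup = record
        { isMonoid = record
          { isSemigroup = record
            { isMagma = record
              { isEquivalence = record
                { refl = refl , ≡ₘ-refl
                ; sym = λ (e₁ , e₂) → sym e₁ , ≡ₘ-sym e₂
                ; trans = λ (e₁ , e₂) (e₁′ , e₂′) → trans e₁ e₁′ , ≡ₘ-trans e₂ e₂′ }
              ; ∙-cong = λ (e₁ , e₂) (e₁′ , e₂′) → ∙-cong e₁ e₁′ , ≡ₘ-+ e₂ e₂′ }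
            ; assoc = λ a b c → assoc _ _ _ , ≡ₘ-reflexive (ℤ.+-assoc (proj₂ a) (proj₂ b) (proj₂ c)) }
          ; identity = (λ a → identityˡ _ , ≡ₘ-reflexive (ℤ.+-identityˡ (proj₂ a)))
                     , (λ a → identityʳ _ , ≡ₘ-reflexive (ℤ.+-identityʳ (proj₂ a))) }
        ; inverse = (λ a → inverseˡ _ , ≡ₘ-reflexive (ℤ.+-inverseˡ (proj₂ a)))
                  , (λ a → inverseʳ _ , ≡ₘ-reflexive (ℤ.+-inverseʳ (proj₂ a)))
        ; ⁻¹-cong = λ (e₁ , e₂) → ⁻¹-cong e₁ , ≡ₘ-neg e₂ }
      ; comm = λ a b → comm _ _ , ≡ₘ-reflexive (ℤ.+-comm (proj₂ a) (proj₂ b)) }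
    }

  G×ℤ/n : FiniteAbelianGroup c ℓ
  G×ℤ/n = record
    { abelianGroup = productGroup
    ; _≟_ = λ a b → (proj₁ a ≟ proj₁ b) ×-dec Dec.map′ mk≡ₘ m∣difference ((+ n) ∣? (proj₂ a -ℤ proj₂ b))
    ; elements = cartesianProduct elements (applyUpTo +_ n)
    ; complete = λ a → cartesianProduct⁺ (complete (proj₁ a)) (applyUpTo⁺ +_ (r≡r%n (proj₂ a)) (n%ℕd<d (proj₂ a) n))
    }

  module P = GroupLemmas G×ℤ/n

  generator : P.Carrier
  generator = ε , + 1

  generator-· : ∀ m → m P.· generator P.≈ (ε , + m)
  generator-· zero = refl , ≡ₘ-refl
  generator-· (suc m) = trans (∙-cong refl (proj₁ (generator-· m))) (identityˡ ε) , ≡ₘ-+ (≡ₘ-refl {+ 1}) (proj₂ (generator-· m))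

  splitting : ∀ {p} (p-prime : Prime p) A → n ≡ p ^ A → Olson.CyclicSplitting p-prime G×ℤ/n G
  splitting {p} p-prime A n≡p^A = record
    { g = generator
    ; a = A
    ; g-order = P.trans (generator-· (p ^ A)) (refl , ∣⇒≡ₘ0 (divides (+ 1) (≡.trans (≡.cong +_ (≡.sym n≡p^A)) (≡.sym (ℤ.*-identityˡ (+ n))))))
    ; ι = λ x → x , + 0
    ; ι-cong = λ eq → eq , ≡ₘ-refl
    ; ι-∙ = λ _ _ → refl , ≡ₘ-refl
    ; decompose = λ a → proj₂ a %ℕ n , proj₁ a ,
        P.sym (P.trans (P.∙-cong (generator-· (proj₂ a %ℕ n)) (refl , ≡ₘ-refl))
          (identityˡ _ , ≡ₘ-trans (≡ₘ-reflexive (ℤ.+-identityʳ _)) (≡ₘ-sym (r≡r%n (proj₂ a)))))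
    ; independent = independent
    }
    where
    independent : ∀ k y → k < p ^ A → (k P.· generator) P.∙ (y , + 0) P.≈ P.ε → (k ≡ 0) × (y ≈ ε)
    independent k y k<p^A eq = k≡0 k n∣k k<p^A , trans (sym (identityˡ y)) (proj₁ eq′)
      where
      eq′ : (ε ∙ y , + k +ℤ + 0) P.≈ (ε , + 0)
      eq′ = P.trans (P.sym (P.∙-cong (generator-· k) (refl , ≡ₘ-refl))) eq
      n∣k : n ∣ℕ k
      n∣k = ≡.subst (n ∣ℕ_) (ℕ.+-identityʳ k) (∣⇒∣ᵤ (≡ₘ0⇒∣ (proj₂ eq′)))
      k≡0 : ∀ k → n ∣ℕ k → k < p ^ A → k ≡ 0
      k≡0 zero _ _ = ≡.refl
      k≡0 (suc k) n∣ k<p^A = ⊥-elim (ℕ.<⇒≱ (≡.subst (suc k <_) (≡.sym n≡p^A) k<p^A) (∣⇒≤ n∣))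

module SubsetCounts {c ℓ : Level} (G : FiniteAbelianGroup c ℓ) where

  open import Data.Nat using (suc; _+_; _<_; s≤s)
  import Data.Nat.Properties as ℕ
  open import Data.List using (List; length; map; filter)
  import Data.List.Properties as List
  open import Data.List.Relation.Unary.All using (universal)
  open import Data.Vec using (Vec; []; _∷_)
  open import Data.Bool using (true; false)
  open import Data.Fin.Subset using (Subset; ∣_∣; inside; outside)
  open import Data.Product using (_×_; _,_)
  open import Relation.Nullary using (does; _×-dec_)
  open import Relation.Unary using (Pred; Decidable)
  open import Relation.Binary.PropositionalEquality as ≡ using (_≡_)
  open Defs using (subSum; allSubsets)
  open GroupLemmas G

  length-filter-map : ∀ {a b p} {A : Set a} {B : Set b} {P : Pred B p} (P? : Decidable P) (f : A → B) xs →
                      length (filter P? (map f xs)) ≡ length (filter (λ x → P? (f x)) xs)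
  length-filter-map P? f List.[] = ≡.refl
  length-filter-map P? f (x List.∷ xs) with does (P? (f x))
  ... | true = ≡.cong suc (length-filter-map P? f xs)
  ... | false = length-filter-map P? f xs

  SizeAndSum : ∀ {t} → Carrier → ℕ → Vec Carrier t → Subset t → Set ℓ
  SizeAndSum x m X I = (∣ I ∣ ≡ m) × (subSum G I X ≈ x)

  sizeAndSum? : ∀ {t} x m (X : Vec Carrier t) → Decidable (SizeAndSum x m X)
  sizeAndSum? x m X I = (∣ I ∣ ℕ.≟ m) ×-dec (subSum G I X ≟ x)

  -- N m X is the case x = ε.
  Nˣ : ∀ {t} → Carrier → ℕ → Vec Carrier t → ℕ
  Nˣ {t} x m X = length (filter (sizeAndSum? x m X) (allSubsets G t))

  Nˣ-∷ : ∀ {t} s (X : Vec Carrier t) x m →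
         Nˣ x m (s ∷ X) ≡ length (filter (λ I → sizeAndSum? x m (s ∷ X) (inside ∷ I)) (allSubsets G t)) + Nˣ x m X
  Nˣ-∷ {t} s X x m = ≡.trans (≡.cong length (List.filter-++ (sizeAndSum? x m (s ∷ X)) (map (inside ∷_) subsets) _))
    (≡.trans (List.length-++ (filter (sizeAndSum? x m (s ∷ X)) (map (inside ∷_) subsets)))
      (≡.cong₂ _+_ (length-filter-map (sizeAndSum? x m (s ∷ X)) (inside ∷_) subsets)
        (≡.trans (length-filter-map (sizeAndSum? x m (s ∷ X)) (outside ∷_) subsets)
          (≡.cong length (List.filter-≐ (λ I → sizeAndSum? x m (s ∷ X) (outside ∷ I)) (sizeAndSum? x m X) ((λ z → z) , (λ z → z)) subsets)))))
    where
    subsets : List (Subset t)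
    subsets = allSubsets G t

  Nˣ-∷-zero : ∀ {t} s (X : Vec Carrier t) x → Nˣ x 0 (s ∷ X) ≡ Nˣ x 0 X
  Nˣ-∷-zero {t} s X x = ≡.trans (Nˣ-∷ s X x 0)
    (≡.cong (λ l → length l + Nˣ x 0 X) (List.filter-none _ (universal (λ { I (() , _) }) (allSubsets G t))))

  -- Pascal's rule: an (m+1)-subset of s ∷ X either uses s or not.
  Nˣ-∷-suc : ∀ {t} s (X : Vec Carrier t) x m → Nˣ x (suc m) (s ∷ X) ≡ Nˣ (x - s) m X + Nˣ x (suc m) X
  Nˣ-∷-suc {t} s X x m = ≡.trans (Nˣ-∷ s X x (suc m))
    (≡.cong (_+ Nˣ x (suc m) X) (≡.cong length (List.filter-≐ (λ I → sizeAndSum? x (suc m) (s ∷ X) (inside ∷ I)) (sizeAndSum? (x - s) m X) ((λ {I} → to {I}) , (λ {I} → from {I})) (allSubsets G t))))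
    where
    to : ∀ {I} → SizeAndSum x (suc m) (s ∷ X) (inside ∷ I) → SizeAndSum (x - s) m X I
    to {I} (size , sum) = ℕ.suc-injective size , trans (sym ([x∙y]-y≈x (subSum G I X) s)) (//-cong₂ (trans (comm _ s) sum) refl)
    from : ∀ {I} → SizeAndSum (x - s) m X I → SizeAndSum x (suc m) (s ∷ X) (inside ∷ I)
    from (size , sum) = ≡.cong suc size , trans (∙-cong refl sum) (x∙[y-x]≈y s x)

  Nˣ-> : ∀ {t} (X : Vec Carrier t) x m → t < m → Nˣ x m X ≡ 0
  Nˣ-> [] x (suc m) _ = ≡.refl
  Nˣ-> (s ∷ X) x (suc m) (s≤s t<m) =
    ≡.trans (Nˣ-∷-suc s X x m) (≡.cong₂ _+_ (Nˣ-> X (x - s) m t<m) (Nˣ-> X x (suc m) (ℕ.m≤n⇒m≤1+n t<m)))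

module DivisibilityIndicator (n : ℕ) where

  open import Data.Integer using (ℤ; +_; -_) renaming (_+_ to _+ℤ_; _-_ to _-ℤ_)
  open import Data.Integer.Properties using (neg-involutive)
  open import Data.Integer.Divisibility.Signed using (_∣?_; ∣m∣n⇒∣m-n; ∣m∣n⇒∣m+n; ∣m⇒∣-m) renaming (_∣_ to _∣ℤ_)
  open import Data.Integer.Tactic.RingSolver using (solve-∀)
  open import Data.Bool using (if_then_else_)
  open import Function.Bundles using (mk⇔)
  open import Relation.Nullary using (¬_; does)
  open import Relation.Nullary.Decidable using (does-⇔; dec-true; dec-false)
  open import Relation.Binary.PropositionalEquality as ≡ using (_≡_)
  open ModularCongruence n

  [n∣_] : ℤ → ℤ
  [n∣ z ] = if does ((+ n) ∣? z) then + 1 else + 0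

  [n∣]-cong : ∀ {z z′} → z ≡ₘ z′ → [n∣ z ] ≡ [n∣ z′ ]
  [n∣]-cong {z} {z′} (mk≡ₘ n∣z-z′) = ≡.cong (if_then + 1 else + 0) (does-⇔ (mk⇔
    (λ n∣z → ≡.subst ((+ n) ∣ℤ_) (cancel z z′) (∣m∣n⇒∣m-n n∣z n∣z-z′))
    (λ n∣z′ → ≡.subst ((+ n) ∣ℤ_) (uncancel z z′) (∣m∣n⇒∣m+n n∣z-z′ n∣z′))) ((+ n) ∣? z) ((+ n) ∣? z′))
    where
    cancel : ∀ a b → a -ℤ (a -ℤ b) ≡ b
    cancel = solve-∀
    uncancel : ∀ a b → (a -ℤ b) +ℤ b ≡ a
    uncancel = solve-∀

  [n∣]-yes : ∀ z → (+ n) ∣ℤ z → [n∣ z ] ≡ + 1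
  [n∣]-yes z n∣z = ≡.cong (if_then + 1 else + 0) (dec-true ((+ n) ∣? z) n∣z)

  [n∣]-no : ∀ z → ¬ (+ n) ∣ℤ z → [n∣ z ] ≡ + 0
  [n∣]-no z n∤z = ≡.cong (if_then + 1 else + 0) (dec-false ((+ n) ∣? z) n∤z)

  [n∣-]≡[n∣] : ∀ z → [n∣ - z ] ≡ [n∣ z ]
  [n∣-]≡[n∣] z = ≡.cong (if_then + 1 else + 0) (does-⇔ (mk⇔
    (λ n∣-z → ≡.subst ((+ n) ∣ℤ_) (neg-involutive z) (∣m⇒∣-m n∣-z)) ∣m⇒∣-m) ((+ n) ∣? (- z)) ((+ n) ∣? z))

module GeneratingFunction {c ℓ : Level} (G : FiniteAbelianGroup c ℓ) (n : ℕ) (n≥1 : 1 ≤ n) where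

  open import Data.Nat using (suc; _+_)
  import Data.Nat.Properties as ℕ
  open import Data.Integer using (ℤ; +_; -_) renaming (_+_ to _+ℤ_; _-_ to _-ℤ_; _*_ to _*ℤ_)
  import Data.Integer.Properties as ℤ
  open import Data.Integer.Tactic.RingSolver using (solve-∀)
  open import Data.List using (List; []; _∷_)
  open import Data.Vec using (Vec) renaming ([] to []ᵥ; _∷_ to _∷ᵥ_)
  open import Data.Bool using (true; false; if_then_else_)
  open import Data.Product using (_,_)
  open import Function.Bundles using (mk⇔)
  open import Relation.Nullary using (does)
  open import Relation.Nullary.Decidable using (does-⇔)
  open import Relation.Binary.PropositionalEquality as ≡ using (_≡_)
  open GroupLemmas G
  open ProductWithCyclic G n n≥1
  open SubsetCounts G
  open FiniteDifferences G×ℤ/n using (Δ*; Respectful)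
  open ModularCongruence n
  open Sums using (sumℤ-suc-difference)
  open DivisibilityIndicator n

  [_≈ε] : Carrier → ℤ
  [ x ≈ε] = if does (x ≟ ε) then + 1 else + 0

  [≈ε]-cong : ∀ {x y} → x ≈ y → [ x ≈ε] ≡ [ y ≈ε]
  [≈ε]-cong {x} {y} x≈y = ≡.cong (if_then + 1 else + 0) (does-⇔ (mk⇔ (trans (sym x≈y)) (trans x≈y)) (x ≟ ε) (y ≟ ε))

  δ : P.Carrier → ℤ
  δ (x , r) = [ x ≈ε] *ℤ [n∣ r ]

  δ-respectful : Respectful δ
  δ-respectful (x≈y , r≡r′) = ≡.cong₂ _*ℤ_ ([≈ε]-cong x≈y) ([n∣]-cong r≡r′)

  lift : ∀ {t} → Vec Carrier t → List P.Carrier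
  lift []ᵥ = []
  lift (s ∷ᵥ X) = (s , + 1) ∷ lift X

  countTerm : ∀ {t} → Vec Carrier t → Carrier → ℤ → ℕ → ℤ
  countTerm X x r m = sign m *ℤ ([n∣ r -ℤ + m ] *ℤ + Nˣ x m X)

  [≈ε]≡Nˣ[] : ∀ x → [ x ≈ε] ≡ + Nˣ x 0 []ᵥ
  [≈ε]≡Nˣ[] x rewrite does-⇔ (mk⇔ sym sym) (x ≟ ε) (ε ≟ x) with does (ε ≟ x)
  ... | true = ≡.refl
  ... | false = ≡.refl

  r-1-m≡r-[1+m] : ∀ r m → r -ℤ + 1 -ℤ + m ≡ r -ℤ + suc m
  r-1-m≡r-[1+m] r m = ≡.trans (shift′ r (+ m)) (≡.cong (λ k → r -ℤ k) (≡.sym (ℤ.pos-+ 1 m)))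
    where
    shift′ : ∀ r m → r -ℤ + 1 -ℤ m ≡ r -ℤ (+ 1 +ℤ m)
    shift′ = solve-∀

  -- Each Δ_(s,1) splits the count according to whether s is used, as in Pascal's rule.
  Δ*-lift-δ : ∀ {t} (X : Vec Carrier t) x r → Δ* (lift X) δ (x , r) ≡ sumℤ (suc t) (countTerm X x r)
  Δ*-lift-δ []ᵥ x r = ≡.trans (≡.cong₂ _*ℤ_ ([≈ε]≡Nˣ[] x) ([n∣]-cong (≡ₘ-reflexive (≡.sym (ℤ.+-identityʳ r)))))
    (reorder (+ Nˣ x 0 []ᵥ) [n∣ r -ℤ + 0 ])
    where
    reorder : ∀ a b → a *ℤ b ≡ + 0 +ℤ + 1 *ℤ (b *ℤ a)
    reorder = solve-∀
  Δ*-lift-δ {suc t} (s ∷ᵥ X) x r = ≡.trans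
    (≡.cong₂ _-ℤ_ (Δ*-lift-δ X x r) (Δ*-lift-δ X (x - s) (r -ℤ + 1)))
    (≡.sym (sumℤ-suc-difference (suc t) (countTerm X x r) (countTerm X (x - s) (r -ℤ + 1)) _
      (≡.cong (λ N → sign 0 *ℤ ([n∣ r -ℤ + 0 ] *ℤ + N)) (Nˣ-∷-zero s X x))
      pascal
      (≡.trans (≡.cong (λ N → sign (suc t) *ℤ ([n∣ r -ℤ + suc t ] *ℤ + N)) (Nˣ-> X x (suc t) (ℕ.n<1+n t)))
        (zero-right (sign (suc t)) [n∣ r -ℤ + suc t ]))))
    where
    zero-right : ∀ a b → a *ℤ (b *ℤ + 0) ≡ + 0
    zero-right = solve-∀
    pascal : ∀ m → countTerm (s ∷ᵥ X) x r (suc m) ≡ countTerm X x r (suc m) -ℤ countTerm X (x - s) (r -ℤ + 1) m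
    pascal m rewrite Nˣ-∷-suc s X x m | ℤ.pos-+ (Nˣ (x - s) m X) (Nˣ x (suc m) X)
                   | r-1-m≡r-[1+m] r m = distrib (sign m) [n∣ r -ℤ + suc m ] (+ Nˣ (x - s) m X) (+ Nˣ x (suc m) X)
      where
      distrib : ∀ s i a b → - s *ℤ (i *ℤ (a +ℤ b)) ≡ - s *ℤ (i *ℤ b) -ℤ s *ℤ (i *ℤ a)
      distrib = solve-∀

module Reindexing (n : ℕ) (n≥1 : 1 ≤ n) where

  open import Data.Nat using (zero; suc; _+_; _*_; _∸_; _<_; s≤s)
  import Data.Nat.Properties as ℕ
  open import Data.Nat.Divisibility using (∣⇒≤; ∣m+n∣m⇒∣n; n∣m*n)
  open import Data.Integer using (ℤ; +_; -[1+_]) renaming (_+_ to _+ℤ_; _-_ to _-ℤ_; _*_ to _*ℤ_)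
  import Data.Integer.Properties as ℤ
  open import Data.Integer.Divisibility.Signed using (divides; ∣⇒∣ᵤ) renaming (_∣_ to _∣ℤ_)
  open import Relation.Nullary using (¬_)
  open import Data.Integer.Tactic.RingSolver using (solve-∀)
  open import Data.Product using (∃; _,_)
  open import Relation.Binary.PropositionalEquality
  open DivisibilityIndicator n
  open Sums

  sumℤ-block : ∀ K (u : ℕ → ℤ) → sumℤ n (λ r → [n∣ + (K * n + r) ] *ℤ u (K * n + r)) ≡ u (K * n)
  sumℤ-block K u = from-n n refl n≥1
    where
    from-n : ∀ n′ → n′ ≡ n → 1 ≤ n′ → sumℤ n′ (λ r → [n∣ + (K * n + r) ] *ℤ u (K * n + r)) ≡ u (K * n)
    from-n (suc n′) n′<n _ = begin
      sumℤ (suc n′) F                             ≡⟨ sumℤ-head n′ F ⟩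
      F 0 +ℤ sumℤ n′ (λ r → F (suc r))            ≡⟨ cong₂ _+ℤ_ F₀ (sumℤ-zero n′ _ rest) ⟩
      u (K * n) +ℤ + 0                            ≡⟨ ℤ.+-identityʳ _ ⟩
      u (K * n)                                   ∎
      where
      open ≡-Reasoning
      F : ℕ → ℤ
      F = λ r → [n∣ + (K * n + r) ] *ℤ u (K * n + r)
      K*n+0 : K * n + 0 ≡ K * n
      K*n+0 = ℕ.+-identityʳ (K * n)
      F₀ : F 0 ≡ u (K * n)
      F₀ = trans (cong₂ _*ℤ_ ([n∣]-yes _ (divides (+ K) (trans (cong +_ K*n+0) (ℤ.pos-* K n)))) (cong u K*n+0))
                 (ℤ.*-identityˡ _)
      rest : ∀ r → r < n′ → F (suc r) ≡ + 0
      rest r r<n′ = trans (cong (_*ℤ u (K * n + suc r)) ([n∣]-no _ n∤)) (ℤ.*-zeroˡ (u (K * n + suc r)))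
        where
        n∤ : ¬ (+ n) ∣ℤ (+ (K * n + suc r))
        n∤ n∣ = ℕ.<⇒≱ (subst (suc r <_) n′<n (s≤s r<n′)) (∣⇒≤ (∣m+n∣m⇒∣n (∣⇒∣ᵤ n∣) (n∣m*n K)))

  sumℤ-multiples : ∀ K (u : ℕ → ℤ) → sumℤ (K * n) (λ M → [n∣ + M ] *ℤ u M) ≡ sumℤ K (λ j → u (j * n))
  sumℤ-multiples zero u = refl
  sumℤ-multiples (suc K) u = begin
    sumℤ (n + K * n) F                                ≡⟨ cong (λ m → sumℤ m F) (ℕ.+-comm n (K * n)) ⟩
    sumℤ (K * n + n) F                                ≡⟨ sumℤ-split (K * n) n F ⟩
    sumℤ (K * n) F +ℤ sumℤ n (λ r → F (K * n + r))    ≡⟨ cong₂ _+ℤ_ (sumℤ-multiples K u) (sumℤ-block K u) ⟩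
    sumℤ K (λ j → u (j * n)) +ℤ u (K * n)             ∎
    where
    open ≡-Reasoning
    F : ℕ → ℤ
    F = λ M → [n∣ + M ] *ℤ u M

  +m-+a≡-[1+k] : ∀ m a → m < a → ∃ λ k → + m -ℤ + a ≡ -[1+ k ]
  +m-+a≡-[1+k] zero (suc a) _ = a , ℤ.+-identityˡ _
  +m-+a≡-[1+k] (suc m) (suc a) (s≤s m<a) with +m-+a≡-[1+k] m a m<a
  ... | k , eq = k , trans (cancel (+ m) (+ a)) eq
    where
    cancel : ∀ x y → (+ 1 +ℤ x) -ℤ (+ 1 +ℤ y) ≡ x -ℤ y
    cancel = solve-∀

  -- Only the indices a + m that are multiples j n of n survive, and they correspond to m = j n - a.
  sumℤ-shifted-multiples : ∀ t (h : ℤ → ℤ) → (∀ k → h -[1+ k ] ≡ + 0) → (∀ m → t < m → h (+ m) ≡ + 0) →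
    ∀ K a → t + a < K * n →
    sumℤ (suc t) (λ m → [n∣ + (a + m) ] *ℤ (sign (a + m) *ℤ h (+ m))) ≡ sumℤ K (λ j → sign (j * n) *ℤ h (+ (j * n) -ℤ + a))
  sumℤ-shifted-multiples t h h<0 h>t K a t+a<Kn = begin
    sumℤ (suc t) Φ                          ≡⟨ sym (sumℤ-vanishing-tail (suc t) tail Φ beyond-t) ⟩
    sumℤ (suc t + tail) Φ                   ≡⟨ cong (λ m → sumℤ m Φ) (ℕ.m+[n∸m]≡n 1+t≤) ⟩
    sumℤ (K * n ∸ a) Φ                      ≡⟨ sumℤ-cong (K * n ∸ a) (λ m _ → shift m) ⟩
    sumℤ (K * n ∸ a) (λ m → F (a + m))      ≡⟨ sym (sumℤ-vanishing-prefix a (K * n ∸ a) F below-a) ⟩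
    sumℤ (a + (K * n ∸ a)) F                ≡⟨ cong (λ m → sumℤ m F) (ℕ.m+[n∸m]≡n a≤Kn) ⟩
    sumℤ (K * n) F                          ≡⟨ sumℤ-multiples K (λ M → sign M *ℤ h (+ M -ℤ + a)) ⟩
    sumℤ K (λ j → sign (j * n) *ℤ h (+ (j * n) -ℤ + a)) ∎
    where
    open ≡-Reasoning
    Φ : ℕ → ℤ
    Φ = λ m → [n∣ + (a + m) ] *ℤ (sign (a + m) *ℤ h (+ m))
    F : ℕ → ℤ
    F = λ M → [n∣ + M ] *ℤ (sign M *ℤ h (+ M -ℤ + a))
    a≤Kn : a ≤ K * n
    a≤Kn = ℕ.≤-trans (ℕ.m≤n+m a t) (ℕ.<⇒≤ t+a<Kn)
    tail : ℕ
    tail = K * n ∸ a ∸ suc t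
    1+t≤ : suc t ≤ K * n ∸ a
    1+t≤ = ℕ.≤-trans (ℕ.≤-reflexive (sym (ℕ.m+n∸n≡m (suc t) a))) (ℕ.∸-monoˡ-≤ a t+a<Kn)
    zero-right : ∀ i s → i *ℤ (s *ℤ + 0) ≡ + 0
    zero-right = solve-∀
    beyond-t : ∀ i → i < tail → Φ (suc t + i) ≡ + 0
    beyond-t i _ = trans (cong (λ v → [n∣ + (a + (suc t + i)) ] *ℤ (sign (a + (suc t + i)) *ℤ v)) (h>t (suc t + i) (ℕ.m≤m+n (suc t) i)))
                         (zero-right [n∣ + (a + (suc t + i)) ] (sign (a + (suc t + i))))
    below-a : ∀ M → M < a → F M ≡ + 0
    below-a M M<a with +m-+a≡-[1+k] M a M<a
    ... | k , eq = trans (cong (λ v → [n∣ + M ] *ℤ (sign M *ℤ h v)) eq)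
                     (trans (cong (λ v → [n∣ + M ] *ℤ (sign M *ℤ v)) (h<0 k)) (zero-right [n∣ + M ] (sign M)))
    shift : ∀ m → Φ m ≡ F (a + m)
    shift m = cong (λ v → [n∣ + (a + m) ] *ℤ (sign (a + m) *ℤ h v))
      (sym (trans (cong (_-ℤ + a) (ℤ.pos-+ a m)) (cancel (+ a) (+ m))))
      where
      cancel : ∀ x y → (x +ℤ y) -ℤ x ≡ y
      cancel = solve-∀

module Expansion {c ℓ : Level} (G : FiniteAbelianGroup c ℓ) (n : ℕ) (n≥1 : 1 ≤ n) where

  open import Data.Nat using (suc; _+_; _*_; _<_; s≤s)
  import Data.Nat.Properties as ℕ
  open import Data.Nat.Combinatorics using (_C_)
  open import Data.Integer using (ℤ; +_; -_) renaming (_+_ to _+ℤ_; _-_ to _-ℤ_; _*_ to _*ℤ_)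
  import Data.Integer.Properties as ℤ
  open import Data.Integer.Divisibility.Signed renaming (_∣_ to _∣ℤ_)
  open import Data.Integer.Tactic.RingSolver using (solve-∀)
  open import Data.List using (List; _++_; replicate; length)
  import Data.List.Properties as List
  open import Data.Vec using (Vec) renaming ([] to []ᵥ; _∷_ to _∷ᵥ_)
  open import Data.Product using (_,_)
  open import Relation.Binary.PropositionalEquality hiding (resp)
  open Defs using (Nℤ)
  open GroupLemmas G using (Carrier; ε; inverseʳ)
  open ProductWithCyclic G n n≥1
  open GeneratingFunction G n n≥1
  open FiniteDifferences G×ℤ/n
  open SubsetCounts G using (Nˣ->)
  open DivisibilityIndicator n
  open Reindexing n n≥1
  open Signs using (sign-+; sign*sign≡1)
  open Sums

  sequence : ∀ {t} → ℕ → Vec Carrier t → List P.Carrier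
  sequence γ J = replicate γ generator ++ lift J

  length-sequence : ∀ {t} γ (J : Vec Carrier t) → length (sequence γ J) ≡ γ + t
  length-sequence γ J = trans (List.length-++ (replicate γ generator)) (cong₂ _+_ (List.length-replicate γ) (length-lift J))
    where
    length-lift : ∀ {t} (J : Vec Carrier t) → length (lift J) ≡ t
    length-lift []ᵥ = refl
    length-lift (s ∷ᵥ J) = cong suc (length-lift J)

  weightedCount : ∀ {t} → Vec Carrier t → ℕ → ℕ → ℕ → (ℕ → ℤ) → ℤ
  weightedCount J γ β k w = sumℤ k (λ j → w j *ℤ sumℤ (γ + 1) (λ i → + (γ C i) *ℤ + Nℤ G (+ (j * n) -ℤ + i -ℤ + β) J))

  Δ*-sequence : ∀ {t} γ (J : Vec Carrier t) r →
    Δ* (sequence γ J) δ (ε , r) ≡ binomialSum γ (λ i → sumℤ (suc t) (countTerm J ε (r -ℤ + i)))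
  Δ*-sequence {t} γ J r = begin
    Δ* (sequence γ J) δ (ε , r)
      ≡⟨ Δ*-++ (replicate γ generator) (lift J) δ (ε , r) ⟩
    Δ* (replicate γ generator) (Δ* (lift J) δ) (ε , r)
      ≡⟨ Δ*-replicate lift-resp generator γ (ε , r) ⟩
    binomialSum γ (λ i → Δ* (lift J) δ ((ε , r) P.- i P.· generator))
      ≡⟨ sumℤ-cong (suc γ) (λ i _ → cong (λ v → sign i *ℤ (+ (γ C i) *ℤ v)) (step i)) ⟩
    binomialSum γ (λ i → sumℤ (suc t) (countTerm J ε (r -ℤ + i))) ∎
    where
    open ≡-Reasoning
    lift-resp : Respectful (Δ* (lift J) δ)
    lift-resp = Δ*-respectful (lift J) δ-respectful
    step : ∀ i → Δ* (lift J) δ ((ε , r) P.- i P.· generator) ≡ sumℤ (suc t) (countTerm J ε (r -ℤ + i))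
    step i = trans (lift-resp shift) (Δ*-lift-δ J ε (r -ℤ + i))
      where
      shift : (ε , r) P.- i P.· generator P.≈ (ε , r -ℤ + i)
      shift = P.trans (P.//-cong₂ (P.refl {ε , r}) (generator-· i)) (inverseʳ ε , ModularCongruence.≡ₘ-refl n)

  -- The term of index m in the i-th count lives at the index a + m, a = i + β, of a single sum over ℕ.
  count-reindexed : ∀ {t} (J : Vec Carrier t) β k i → t + (i + β) < k * n →
    sign i *ℤ sumℤ (suc t) (countTerm J ε (- + β -ℤ + i))
      ≡ sign β *ℤ sumℤ k (λ j → sign (j * n) *ℤ + Nℤ G (+ (j * n) -ℤ + (i + β)) J)
  count-reindexed {t} J β k i bound = begin
    sign i *ℤ sumℤ (suc t) (countTerm J ε (- + β -ℤ + i))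
      ≡⟨ sym (sumℤ-distribˡ (suc t) (sign i) _) ⟩
    sumℤ (suc t) (λ m → sign i *ℤ countTerm J ε (- + β -ℤ + i) m)
      ≡⟨ sumℤ-cong (suc t) (λ m _ → termwise m) ⟩
    sumℤ (suc t) (λ m → sign β *ℤ ([n∣ + (i + β + m) ] *ℤ (sign (i + β + m) *ℤ h (+ m))))
      ≡⟨ sumℤ-distribˡ (suc t) (sign β) _ ⟩
    sign β *ℤ sumℤ (suc t) (λ m → [n∣ + (i + β + m) ] *ℤ (sign (i + β + m) *ℤ h (+ m)))
      ≡⟨ cong (sign β *ℤ_) (sumℤ-shifted-multiples t h (λ _ → refl)
        (λ m t<m → cong +_ (Nˣ-> J ε m t<m)) k (i + β) bound) ⟩
    sign β *ℤ sumℤ k (λ j → sign (j * n) *ℤ h (+ (j * n) -ℤ + (i + β))) ∎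
    where
    open ≡-Reasoning
    h : ℤ → ℤ
    h z = + Nℤ G z J
    index : ∀ m → - + β -ℤ + i -ℤ + m ≡ - + (i + β + m)
    index m = trans (negate (+ β) (+ i) (+ m)) (cong -_ (sym (trans (ℤ.pos-+ (i + β) m) (cong (_+ℤ + m) (ℤ.pos-+ i β)))))
      where
      negate : ∀ b i m → - b -ℤ i -ℤ m ≡ - (i +ℤ b +ℤ m)
      negate = solve-∀
    signs : ∀ m → sign i *ℤ sign m ≡ sign β *ℤ sign (i + β + m)
    signs m = sym (begin
      sign β *ℤ sign (i + β + m)
        ≡⟨ cong (sign β *ℤ_) (trans (sign-+ (i + β) m) (cong (_*ℤ sign m) (sign-+ i β))) ⟩
      sign β *ℤ (sign i *ℤ sign β *ℤ sign m)
        ≡⟨ regroup (sign β) (sign i) (sign m) ⟩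
      sign β *ℤ sign β *ℤ (sign i *ℤ sign m)
        ≡⟨ cong (_*ℤ (sign i *ℤ sign m)) (sign*sign≡1 β) ⟩
      + 1 *ℤ (sign i *ℤ sign m)
        ≡⟨ ℤ.*-identityˡ _ ⟩
      sign i *ℤ sign m ∎)
      where
      regroup : ∀ b i m → b *ℤ (i *ℤ b *ℤ m) ≡ b *ℤ b *ℤ (i *ℤ m)
      regroup = solve-∀
    termwise : ∀ m → sign i *ℤ countTerm J ε (- + β -ℤ + i) m ≡ sign β *ℤ ([n∣ + (i + β + m) ] *ℤ (sign (i + β + m) *ℤ h (+ m)))
    termwise m rewrite index m | [n∣-]≡[n∣] (+ (i + β + m)) =
      move (sign i) (sign m) (sign β) (sign (i + β + m)) [n∣ + (i + β + m) ] (h (+ m)) (signs m)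
      where
      move : ∀ si sm sb sa d N → si *ℤ sm ≡ sb *ℤ sa → si *ℤ (sm *ℤ (d *ℤ N)) ≡ sb *ℤ (d *ℤ (sa *ℤ N))
      move si sm sb sa d N eq = trans (assoc₁ si sm d N) (trans (cong (_*ℤ (d *ℤ N)) eq) (assoc₂ sb sa d N))
        where
        assoc₁ : ∀ si sm d N → si *ℤ (sm *ℤ (d *ℤ N)) ≡ si *ℤ sm *ℤ (d *ℤ N)
        assoc₁ = solve-∀
        assoc₂ : ∀ sb sa d N → sb *ℤ sa *ℤ (d *ℤ N) ≡ sb *ℤ (d *ℤ (sa *ℤ N))
        assoc₂ = solve-∀

  Δ*-sequence≡weightedCount : ∀ {t} γ β k (J : Vec Carrier t) → t + γ + β + 1 ≤ k * n →
    Δ* (sequence γ J) δ (ε , - + β) ≡ sign β *ℤ weightedCount J γ β k (λ j → sign (j * n))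
  Δ*-sequence≡weightedCount {t} γ β k J bound = begin
    Δ* (sequence γ J) δ (ε , - + β)
      ≡⟨ Δ*-sequence γ J (- + β) ⟩
    sumℤ (suc γ) (λ i → sign i *ℤ (+ (γ C i) *ℤ S i))
      ≡⟨ sumℤ-cong (suc γ) (λ i i≤γ → reindex i i≤γ) ⟩
    sumℤ (suc γ) (λ i → sign β *ℤ (+ (γ C i) *ℤ R i))
      ≡⟨ sumℤ-distribˡ (suc γ) (sign β) _ ⟩
    sign β *ℤ sumℤ (suc γ) (λ i → + (γ C i) *ℤ R i)
      ≡⟨ cong (sign β *ℤ_) (sym (sumℤ-comm-weighted k (suc γ) (λ j → sign (j * n)) (λ i → + (γ C i)) X)) ⟩
    sign β *ℤ sumℤ k (λ j → sign (j * n) *ℤ sumℤ (suc γ) (λ i → + (γ C i) *ℤ X j i))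
      ≡⟨ cong (λ m → sign β *ℤ sumℤ k (λ j → sign (j * n) *ℤ sumℤ m (λ i → + (γ C i) *ℤ X j i))) (ℕ.+-comm 1 γ) ⟩
    sign β *ℤ weightedCount J γ β k (λ j → sign (j * n)) ∎
    where
    open ≡-Reasoning
    S : ℕ → ℤ
    S i = sumℤ (suc t) (countTerm J ε (- + β -ℤ + i))
    X : ℕ → ℕ → ℤ
    X j i = + Nℤ G (+ (j * n) -ℤ + i -ℤ + β) J
    R : ℕ → ℤ
    R i = sumℤ k (λ j → sign (j * n) *ℤ X j i)
    bound-i : ∀ i → i < suc γ → t + (i + β) < k * n
    bound-i i (s≤s i≤γ) = ℕ.<-≤-trans (s≤s (ℕ.≤-trans (ℕ.+-monoʳ-≤ t (ℕ.+-monoˡ-≤ β i≤γ)) (ℕ.≤-reflexive (sym (ℕ.+-assoc t γ β)))))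
                            (subst (_≤ k * n) (ℕ.+-comm (t + γ + β) 1) bound)
    reindex : ∀ i → i < suc γ → sign i *ℤ (+ (γ C i) *ℤ S i) ≡ sign β *ℤ (+ (γ C i) *ℤ R i)
    reindex i i≤γ = trans (swap (sign i) (+ (γ C i)) (S i)) (trans (cong (+ (γ C i) *ℤ_) (trans (count-reindexed J β k i (bound-i i i≤γ))
      (cong (λ v → sign β *ℤ v) (sumℤ-cong k (λ j _ → cong (λ z → sign (j * n) *ℤ + Nℤ G z J) (split (j * n) i)))))) (swap (+ (γ C i)) (sign β) (R i)))
      where
      swap : ∀ a b c → a *ℤ (b *ℤ c) ≡ b *ℤ (a *ℤ c)
      swap = solve-∀
      split : ∀ a i → + a -ℤ + (i + β) ≡ + a -ℤ + i -ℤ + β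
      split a i = trans (cong (λ z → + a -ℤ z) (ℤ.pos-+ i β)) (assoc (+ a) (+ i) (+ β))
        where
        assoc : ∀ a i b → a -ℤ (i +ℤ b) ≡ a -ℤ i -ℤ b
        assoc = solve-∀

  weightedCount-congruent : ∀ {t} (J : Vec Carrier t) γ β k d (w w′ : ℕ → ℤ) → (∀ j → d ∣ℤ (w j -ℤ w′ j)) →
                            d ∣ℤ (weightedCount J γ β k w -ℤ weightedCount J γ β k w′)
  weightedCount-congruent J γ β k d w w′ d∣ = ∣sumℤ-sumℤ k d _ _ λ j _ →
    subst (d ∣ℤ_) (distrib (w j) (w′ j) _) (∣m⇒∣m*n _ (d∣ j))
    where
    distrib : ∀ a b x → (a -ℤ b) *ℤ x ≡ a *ℤ x -ℤ b *ℤ x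
    distrib = solve-∀

module ProductVanishing {c ℓ : Level} (G : FiniteAbelianGroup c ℓ) {p n D : ℕ} (p-prime : Prime p)
                        (pGroup : Defs.IsPGroup G p) (exponent : Defs.IsExponent G n) (davenport : Defs.IsDavenport G D) where

  open import Data.Nat using (suc; _+_; _∸_; _<_; >-nonZero; s<s⁻¹)
  import Data.Nat.Properties as ℕ
  open import Data.Integer using (+_)
  open import Data.List using (length)
  open import Data.Product using (∃; _×_; _,_; proj₁)
  open import Relation.Binary.PropositionalEquality using (subst; cong)
  open ProductWithCyclic G n (proj₁ exponent)
  open FiniteDifferences G×ℤ/n using (Δ*; Respectful; _∣ᶠ_)
  open MaximalOrder G p-prime pGroup using (A; exponent≡p^A)
  open Olson

  -- G × ℤ/n = ⟨(ε, 1)⟩ ⊕ G with (ε, 1) of order n, and Olson's bound for G lies below D(G).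
  G×ℤ/n-vanishes : ∀ ys → D + n ≤ length ys + 1 → ∀ F → Respectful F → (+ p) ∣ᶠ Δ* ys F
  G×ℤ/n-vanishes ys bound = from-olson (PGroupStructure.olson p-prime _ G ℕ.≤-refl pGroup)
    where
    from-olson : (∃ λ w → DifferencesVanishAbove G p w × ZeroSumFreeOfLength G w) →
                 ∀ F → Respectful F → (+ p) ∣ᶠ Δ* ys F
    from-olson (w , vanish , free) =
      differencesVanish p-prime G×ℤ/n G (splitting p-prime A (exponent≡p^A exponent)) w vanish ys
        (subst (λ m → m ∸ 1 + w < length ys) (exponent≡p^A exponent) n-1+w<ys)
      where
      n-1+w<ys : n ∸ 1 + w < length ys
      n-1+w<ys = s<s⁻¹ (begin-strict
        suc (n ∸ 1) + w   ≡⟨ cong (_+ w) (ℕ.suc-pred n {{>-nonZero (proj₁ exponent)}}) ⟩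
        n + w             <⟨ ℕ.+-monoʳ-< n (zeroSumFree⇒<D G davenport free) ⟩
        n + D             ≡⟨ ℕ.+-comm n D ⟩
        D + n             ≤⟨ bound ⟩
        length ys + 1     ≡⟨ ℕ.+-comm (length ys) 1 ⟩
        suc (length ys)   ∎)
        where open ℕ.≤-Reasoning

open import Defs
open import Level using (Level)
open import Data.Nat using (ℕ; _+_; _*_; _≤_)
open import Data.Nat.Primality using (Prime)
open import Data.Nat.Combinatorics using (_C_)
open import Data.Integer using (+_; _-_) renaming (_*_ to _*ℤ_)
open import Data.Integer.Divisibility using (_∣_)
open import Data.Vec using (Vec)

open import Data.Integer using (ℤ; -_)
open import Data.Integer.Divisibility.Signed using (∣⇒∣ᵤ; ∣m∣n⇒∣m-n; ∣n⇒∣m*n) renaming (_∣_ to _∣ℤ_)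
open import Data.Integer.Tactic.RingSolver using (solve-∀)
open import Data.Product using (_,_; proj₁)
open import Relation.Binary.PropositionalEquality using (_≡_; subst; sym; trans)
open import Data.List using (length)

lemma3p2 : ∀ {c ℓ : Level} (G : FiniteAbelianGroup c ℓ) (p n D γ β k t : ℕ)
    → Prime p → IsPGroup G p → IsExponent G n → IsDavenport G D → 2 ≤ k
    → (J : Vec (FiniteAbelianGroup.Carrier G) t)
    → D + n ≤ t + γ + 1
    → t + γ + β + 1 ≤ k * n
    → (+ p) ∣ sumℤ k (λ j → sign j *ℤ
          sumℤ (γ + 1) (λ i → (+ (γ C i)) *ℤ (+ Nℤ G ((+ (j * n) - + i) - + β) J)))
lemma3p2 G p n D γ β k t p-prime pGroup exponent davenport _ J D+n≤t+γ+1 bound =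
  ∣⇒∣ᵤ (subst ((+ p) ∣ℤ_) (cancel count[sign[j*n]] (weightedCount J γ β k sign))
    (∣m∣n⇒∣m-n p∣count[sign[j*n]] (weightedCount-congruent J γ β k (+ p) (λ j → sign (j * n)) sign sign[j*n]≡sign[j])))
  where
  open GroupLemmas G using (ε)
  open ProductWithCyclic G n (proj₁ exponent) using (G×ℤ/n)
  open FiniteDifferences G×ℤ/n using (at)
  open GeneratingFunction G n (proj₁ exponent) using (δ; δ-respectful)
  open Expansion G n (proj₁ exponent)
  open ProductVanishing G p-prime pGroup exponent davenport
  open MaximalOrder G p-prime pGroup using (A; exponent≡p^A)
  cancel : ∀ a b → a - (a - b) ≡ b
  cancel = solve-∀
  long-enough : D + n ≤ length (sequence γ J) + 1
  long-enough = subst (λ m → D + n ≤ m + 1) (trans (Data.Nat.Properties.+-comm t γ) (sym (length-sequence γ J))) D+n≤t+γ+1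
  count[sign[j*n]] : ℤ
  count[sign[j*n]] = weightedCount J γ β k (λ j → sign (j * n))
  p∣count[sign[j*n]] : (+ p) ∣ℤ count[sign[j*n]]
  p∣count[sign[j*n]] = subst ((+ p) ∣ℤ_) (Signs.sign*[sign*x]≡x β count[sign[j*n]]) (∣n⇒∣m*n (sign β)
    (subst ((+ p) ∣ℤ_) (Δ*-sequence≡weightedCount γ β k J bound)
      (at (G×ℤ/n-vanishes (sequence γ J) long-enough δ δ-respectful) (ε , - (+ β)))))
  sign[j*n]≡sign[j] : ∀ j → (+ p) ∣ℤ (sign (j * n) - sign j)
  sign[j*n]≡sign[j] j = subst (λ m → (+ p) ∣ℤ (sign (j * m) - sign j)) (sym (exponent≡p^A exponent))
    (Signs.sign[j*p^a]≡sign[j] p-prime A j)
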